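{- Let $n\ge 2$ and let $K_n$ be the complete graph on vertex set $[n]$ with Baker–Norine rank $r_{{\rm BN},K_n}$. Let $\mathcal A=\{\mathbf a\in\mathbb Z^n : a_1,\ldots,a_{n-2}\in\{0,\ldots,n-1\},\ a_{n-1}=0\}$. Then for every $\mathbf a\in\mathcal A$, $$ r_{{\rm BN},K_n}(\mathbf a)=-1+\Bigl|\Bigl\{ i\in\{0,\ldots,\deg(\mathbf a)\} \;:\; \sum_{j=1}^{n-2}\bigl((a_j+i)\bmod n\bigr)\le \deg(\mathbf a)-i\Bigr\}\Bigr|. $$ Moreover, for every $\mathbf d\in\mathbb Z^n$, $$ r_{{\rm BN},K_n}(\mathbf d)=-1+\Bigl|\Bigl\{ i\in\{0,\ldots,\deg(\mathbf d)\} \;:\; \sum_{j=1}^{n-2}\bigl((d_j-d_{n-1}+i)\bmod n\bigr)\le \deg(\mathbf d)-i\Bigr\}\Bigr|. $$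
   Context: $\deg(\mathbf d)=d_1+\cdots+d_n$. For an integer $x$, $x\bmod n$ denotes the unique element of $\{0,\ldots,n-1\}$ congruent to $x$ modulo $n$. The set $\{0,\ldots,m\}$ is empty when $m<0$. For a connected graph $G$ without self-loops on ordered vertices $v_1,\ldots,v_n$, let $\Delta_G$ be its Laplacian (degree matrix minus adjacency matrix) viewed as a map $\mathbb Z^n\to\mathbb Z^n$; $\mathbf d\sim\mathbf d'$ iff $\mathbf d-\mathbf d'\in\mathrm{Image}(\Delta_G)$; $\mathcal N$ is the set of $\mathbf d\in\mathbb Z^n$ not equivalent to any componentwise nonnegative vector; $f(\mathbf d)=\min_{\mathbf d'\in\mathcal N}\|\mathbf d-\mathbf d'\|_1$; and the Baker–Norine rank is $r_{\rm BN}=f-1$. -}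

module Defs where

open import Data.Nat as ℕ using (ℕ; zero; suc)
open import Data.Integer as ℤ using (ℤ; +_; -[1+_]; _-_; _*_; ∣_∣; _%ℕ_)
open import Data.Fin using (Fin; zero; suc; inject₁; fromℕ; _≟_)
open import Data.List using (List; []; _∷_; upTo; filter; length)
open import Data.Product using (Σ; ∃; _×_; _,_)
open import Relation.Nullary using (¬_; yes; no)
open import Relation.Binary.PropositionalEquality using (_≡_)

sumℕ : (n : ℕ) → (Fin n → ℕ) → ℕ
sumℕ zero    f = 0
sumℕ (suc n) f = f zero ℕ.+ sumℕ n (λ i → f (suc i))

sumℤ : (n : ℕ) → (Fin n → ℤ) → ℤ
sumℤ zero    f = + 0
sumℤ (suc n) f = f zero ℤ.+ sumℤ n (λ i → f (suc i))

-- Divisors on vertices v_1,…,v_n, indexed by Fin n (v_{k+1} ↦ index k)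
Divisor : ℕ → Set
Divisor n = Fin n → ℤ

deg : {n : ℕ} → Divisor n → ℤ
deg {n} d = sumℤ n d

dist₁ : {n : ℕ} → Divisor n → Divisor n → ℕ
dist₁ {n} d d' = sumℕ n (λ i → ∣ d i - d' i ∣)

record Graph (n : ℕ) : Set where
  field
    adj      : Fin n → Fin n → ℕ
    symmetric : ∀ i j → adj i j ≡ adj j i
    loopless : ∀ i → adj i i ≡ 0

-- Laplacian Δ_G = D - A as a map ℤ^n → ℤ^n:
-- (Δ x)_i = deg(v_i) x_i - Σ_j A_ij x_j = Σ_j A_ij (x_i - x_j)
laplacian : {n : ℕ} → Graph n → Divisor n → Divisor n
laplacian {n} G x i = sumℤ n (λ j → + Graph.adj G i j * (x i - x j))

_∼⟨_⟩_ : {n : ℕ} → Divisor n → Graph n → Divisor n → Set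
_∼⟨_⟩_ {n} d G d' = Σ (Divisor n) λ x → ∀ i → d i - d' i ≡ laplacian G x i

Nonneg : {n : ℕ} → Divisor n → Set
Nonneg d = ∀ i → + 0 ℤ.≤ d i

InN : {n : ℕ} → Graph n → Divisor n → Set
InN {n} G d = ¬ (Σ (Divisor n) λ e → Nonneg e × (d ∼⟨ G ⟩ e))

IsF : {n : ℕ} → Graph n → Divisor n → ℕ → Set
IsF {n} G d m =
  (Σ (Divisor n) λ d' → InN G d' × dist₁ d d' ≡ m) ×
  (∀ (d' : Divisor n) → InN G d' → m ℕ.≤ dist₁ d d')

RankBN : {n : ℕ} → Graph n → Divisor n → ℤ → Set
RankBN G d r = Σ ℕ λ m → IsF G d m × r ≡ + m - + 1

Kadj : {n : ℕ} → Fin n → Fin n → ℕ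
Kadj i j with i ≟ j
... | yes _ = 0
... | no  _ = 1

K : (n : ℕ) → Graph n
K n = record { adj = Kadj ; symmetric = sym′ ; loopless = loop }
  where
  open import Relation.Binary.PropositionalEquality using (refl; sym)
  open import Data.Empty using (⊥-elim)
  sym′ : ∀ i j → Kadj i j ≡ Kadj j i
  sym′ i j with i ≟ j | j ≟ i
  ... | yes _ | yes _ = refl
  ... | no  _ | no  _ = refl
  ... | yes p | no ¬q = ⊥-elim (¬q (sym p))
  ... | no ¬p | yes q = ⊥-elim (¬p (sym q))
  loop : ∀ i → Kadj i i ≡ 0
  loop i with i ≟ i
  ... | yes _ = refl
  ... | no ¬p = ⊥-elim (¬p refl)

-- Vertex indices for n = k + 2 vertices:
-- vertex v_{j+1} for j < k (i.e. v_1,…,v_{n-2}), and vertex v_{n-1}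
vtx : {k : ℕ} → Fin k → Fin (suc (suc k))
vtx t = inject₁ (inject₁ t)

vₙ₋₁ : (k : ℕ) → Fin (suc (suc k))
vₙ₋₁ k = inject₁ (fromℕ k)

range : ℤ → List ℕ
range (+ m)    = upTo (suc m)
range -[1+ _ ] = []

countLe : ℤ → (ℕ → ℤ) → (ℕ → ℤ) → ℕ
countLe D L R = length (filter (λ i → L i ℤ.≤? R i) (range D))

InA : (k : ℕ) → Divisor (suc (suc k)) → Set
InA k a = (∀ (j : Fin k) → + 0 ℤ.≤ a (vtx j) × a (vtx j) ℤ.< + (suc (suc k)))
        × a (vₙ₋₁ k) ≡ + 0

-- For n = k + 2 call i ∈ {0,…,deg d} admissible if Σⱼ ((dⱼ − dₙ₋₁ + i) mod n) ≤ deg d − i, and let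
-- ρ(d) be the number of admissible i, so that the claim is f = ρ. Three facts suffice.
-- (1) ρ(d) = 0 iff d ∈ 𝒩: an admissible i yields an effective divisor equivalent to d (residues
-- on v₁,…,vₙ₋₂, i chips on vₙ₋₁, the rest on vₙ); conversely an effective e ∼ d makes eₙ₋₁ admissible.
-- (2) Removing one chip changes ρ by at most one: at vₙ₋₁ the admissible indices shift down by one;
-- elsewhere none is gained, and the lost ones are congruent modulo n and lie in a window of length n.
-- (3) If ρ(d) > 0, removing a chip at vₙ or at a vertex with residue 0 at the largest admissible
-- index lowers ρ.
-- A function vanishing exactly on 𝒩, 1-Lipschitz along unit steps and lowerable off 𝒩 by a
-- unit step is the ℓ¹-distance to 𝒩.

module Submission where

open import Defs
open import Data.Nat as ℕ using (ℕ; zero; suc; z≤n; s≤s)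
import Data.Nat.Properties as ℕP
import Data.Nat.DivMod as ℕD
open import Data.Integer as ℤ using (ℤ; +_; -[1+_]; _+_; _-_; _*_; -_; ∣_∣; _%ℕ_; _/ℕ_)
import Data.Integer.Properties as ℤP
import Data.Integer.DivMod as ℤD
open import Data.Fin as F using (Fin; zero; suc; inject₁; fromℕ; toℕ)
import Data.Fin.Properties as FP
open import Data.Vec.Functional using (updateAt)
open import Data.Vec.Functional.Properties using (updateAt-updates; updateAt-minimal)
open import Data.List using (applyUpTo; filter; length)
open import Data.List.Properties using (filter-≐)
open import Data.Product using (∃; _×_; _,_; proj₁; proj₂)
open import Data.Sum using (_⊎_; inj₁; inj₂; [_,_])
open import Data.Empty using (⊥; ⊥-elim)
open import Relation.Nullary using (¬_; Dec; yes; no)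
open import Relation.Binary.PropositionalEquality hiding ([_])
open import Function using (_∘_)
import Data.Nat.Tactic.RingSolver as ℕSolver
import Data.Integer.Tactic.RingSolver as ℤSolver

-- Finite sums

sumℕ-cong : ∀ n {f g : Fin n → ℕ} → (∀ i → f i ≡ g i) → sumℕ n f ≡ sumℕ n g
sumℕ-cong zero    f≗g = refl
sumℕ-cong (suc n) f≗g = cong₂ ℕ._+_ (f≗g zero) (sumℕ-cong n (f≗g ∘ suc))

sumℤ-cong : ∀ n {f g : Fin n → ℤ} → (∀ i → f i ≡ g i) → sumℤ n f ≡ sumℤ n g
sumℤ-cong zero    f≗g = refl
sumℤ-cong (suc n) f≗g = cong₂ _+_ (f≗g zero) (sumℤ-cong n (f≗g ∘ suc))

sumℕ-mono-≤ : ∀ n {f g : Fin n → ℕ} → (∀ i → f i ℕ.≤ g i) → sumℕ n f ℕ.≤ sumℕ n g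
sumℕ-mono-≤ zero    f≤g = z≤n
sumℕ-mono-≤ (suc n) f≤g = ℕP.+-mono-≤ (f≤g zero) (sumℕ-mono-≤ n (f≤g ∘ suc))

sumℕ-mono-≤-at : ∀ n {f g : Fin n → ℕ} j c → (∀ i → f i ℕ.≤ g i) → f j ℕ.+ c ℕ.≤ g j →
                 sumℕ n f ℕ.+ c ℕ.≤ sumℕ n g
sumℕ-mono-≤-at (suc n) {f} zero c f≤g fj+c≤gj =
  ℕP.≤-trans (ℕP.≤-reflexive (swap (f zero) _ c)) (ℕP.+-mono-≤ fj+c≤gj (sumℕ-mono-≤ n (f≤g ∘ suc)))
  where swap : ∀ a b c → a ℕ.+ b ℕ.+ c ≡ a ℕ.+ c ℕ.+ b
        swap = ℕSolver.solve-∀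
sumℕ-mono-≤-at (suc n) {f} (suc j) c f≤g fj+c≤gj =
  ℕP.≤-trans (ℕP.≤-reflexive (ℕP.+-assoc (f zero) _ c))
             (ℕP.+-mono-≤ (f≤g zero) (sumℕ-mono-≤-at n j c (f≤g ∘ suc) fj+c≤gj))

sumℕ-suc : ∀ n (f : Fin n → ℕ) → sumℕ n (suc ∘ f) ≡ sumℕ n f ℕ.+ n
sumℕ-suc zero    f = refl
sumℕ-suc (suc n) f = trans (cong (λ s → suc (f zero ℕ.+ s)) (sumℕ-suc n (f ∘ suc))) (shuffle (f zero) _ n)
  where shuffle : ∀ a b n → suc (a ℕ.+ (b ℕ.+ n)) ≡ a ℕ.+ b ℕ.+ suc n
        shuffle = ℕSolver.solve-∀

sumℕ≡0⇒≡0 : ∀ n (f : Fin n → ℕ) → sumℕ n f ≡ 0 → ∀ i → f i ≡ 0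
sumℕ≡0⇒≡0 (suc n) f Σ≡0 zero    = ℕP.m+n≡0⇒m≡0 (f zero) Σ≡0
sumℕ≡0⇒≡0 (suc n) f Σ≡0 (suc i) = sumℕ≡0⇒≡0 n (f ∘ suc) (ℕP.m+n≡0⇒n≡0 (f zero) Σ≡0) i

sumℕ≢0⇒∃≢0 : ∀ n (f : Fin n → ℕ) t → sumℕ n f ≡ suc t → ∃ λ i → ∃ λ u → f i ≡ suc u
sumℕ≢0⇒∃≢0 (suc n) f t Σ≡1+t with f zero in eq
... | suc u = zero , u , eq
... | zero  = let (i , u , fi≡1+u) = sumℕ≢0⇒∃≢0 n (f ∘ suc) t Σ≡1+t in suc i , u , fi≡1+u

sumℕ-exchange : ∀ n (f g : Fin n → ℕ) v → (∀ i → i ≢ v → f i ≡ g i) →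
                sumℕ n f ℕ.+ g v ≡ sumℕ n g ℕ.+ f v
sumℕ-exchange (suc n) f g zero f≗g = trans (cong (λ s → f zero ℕ.+ s ℕ.+ g zero) tail≡) (swap (f zero) _ (g zero))
  where tail≡ = sumℕ-cong n (λ i → f≗g (suc i) (λ ()))
        swap : ∀ a b c → a ℕ.+ b ℕ.+ c ≡ c ℕ.+ b ℕ.+ a
        swap = ℕSolver.solve-∀
sumℕ-exchange (suc n) f g (suc v) f≗g = begin
  f zero ℕ.+ sumℕ n (f ∘ suc) ℕ.+ g (suc v)   ≡⟨ cong (λ x → x ℕ.+ _ ℕ.+ _) (f≗g zero (λ ())) ⟩
  g zero ℕ.+ sumℕ n (f ∘ suc) ℕ.+ g (suc v)   ≡⟨ ℕP.+-assoc (g zero) _ _ ⟩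
  g zero ℕ.+ (sumℕ n (f ∘ suc) ℕ.+ g (suc v)) ≡⟨ cong (g zero ℕ.+_) (sumℕ-exchange n _ _ v (λ i i≢v → f≗g (suc i) (i≢v ∘ FP.suc-injective))) ⟩
  g zero ℕ.+ (sumℕ n (g ∘ suc) ℕ.+ f (suc v)) ≡⟨ ℕP.+-assoc (g zero) _ _ ⟨
  g zero ℕ.+ sumℕ n (g ∘ suc) ℕ.+ f (suc v)   ∎
  where open ≡-Reasoning

sumℤ-exchange : ∀ n (f g : Fin n → ℤ) v → (∀ i → i ≢ v → f i ≡ g i) →
                sumℤ n f + g v ≡ sumℤ n g + f v
sumℤ-exchange (suc n) f g zero f≗g = trans (cong (λ s → f zero + s + g zero) tail≡) (swap (f zero) _ (g zero))
  where tail≡ = sumℤ-cong n (λ i → f≗g (suc i) (λ ()))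
        swap : ∀ a b c → a + b + c ≡ c + b + a
        swap = ℤSolver.solve-∀
sumℤ-exchange (suc n) f g (suc v) f≗g = begin
  f zero + sumℤ n (f ∘ suc) + g (suc v)   ≡⟨ cong (λ x → x + _ + _) (f≗g zero (λ ())) ⟩
  g zero + sumℤ n (f ∘ suc) + g (suc v)   ≡⟨ ℤP.+-assoc (g zero) _ _ ⟩
  g zero + (sumℤ n (f ∘ suc) + g (suc v)) ≡⟨ cong (λ x → g zero + x) (sumℤ-exchange n _ _ v (λ i i≢v → f≗g (suc i) (i≢v ∘ FP.suc-injective))) ⟩
  g zero + (sumℤ n (g ∘ suc) + f (suc v)) ≡⟨ ℤP.+-assoc (g zero) _ _ ⟨
  g zero + sumℤ n (g ∘ suc) + f (suc v)   ∎
  where open ≡-Reasoning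

sumℤ-last : ∀ n (f : Fin (suc n) → ℤ) → sumℤ (suc n) f ≡ sumℤ n (f ∘ inject₁) + f (fromℕ n)
sumℤ-last zero    f = ℤP.+-comm (f zero) (+ 0)
sumℤ-last (suc n) f = trans (cong (λ x → f zero + x) (sumℤ-last n (f ∘ suc))) (sym (ℤP.+-assoc (f zero) _ _))

sumℤ-pos : ∀ n (f : Fin n → ℕ) → sumℤ n (+_ ∘ f) ≡ + sumℕ n f
sumℤ-pos zero    f = refl
sumℤ-pos (suc n) f = trans (cong (λ x → + f zero + x) (sumℤ-pos n (f ∘ suc))) (sym (ℤP.pos-+ (f zero) _))

sumℤ-distrib-+ : ∀ n (f g : Fin n → ℤ) → sumℤ n (λ i → f i + g i) ≡ sumℤ n f + sumℤ n g
sumℤ-distrib-+ zero    f g = refl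
sumℤ-distrib-+ (suc n) f g =
  trans (cong (λ x → f zero + g zero + x) (sumℤ-distrib-+ n (f ∘ suc) (g ∘ suc))) (shuffle (f zero) (g zero) _ _)
  where shuffle : ∀ a b c d → a + b + (c + d) ≡ a + c + (b + d)
        shuffle = ℤSolver.solve-∀

sumℤ-distrib-neg : ∀ n (f : Fin n → ℤ) → sumℤ n (-_ ∘ f) ≡ - sumℤ n f
sumℤ-distrib-neg zero    f = refl
sumℤ-distrib-neg (suc n) f = trans (cong (λ x → - f zero + x) (sumℤ-distrib-neg n (f ∘ suc))) (sym (ℤP.neg-distrib-+ (f zero) _))

sumℤ-*ʳ : ∀ n (f : Fin n → ℤ) c → sumℤ n (λ i → f i * c) ≡ sumℤ n f * c
sumℤ-*ʳ zero    f c = refl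
sumℤ-*ʳ (suc n) f c = trans (cong (λ x → f zero * c + x) (sumℤ-*ʳ n (f ∘ suc) c)) (sym (ℤP.*-distribʳ-+ c (f zero) _))

sumℤ-const : ∀ n c → sumℤ n (λ _ → c) ≡ + n * c
sumℤ-const zero    c = refl
sumℤ-const (suc n) c = trans (cong (λ x → c + x) (sumℤ-const n c)) (unfold c (+ n))
  where unfold : ∀ c m → c + m * c ≡ (+ 1 + m) * c
        unfold = ℤSolver.solve-∀

-- Residues modulo N

private
  no-positive-shift : ∀ N a b t → b ℕ.< a ℕ.+ N → + b ≡ + a + + suc t * + N → ⊥
  no-positive-shift N a b t b<a+N b≡a+tN = ℕP.<-irrefl refl (ℕP.<-≤-trans b<a+N a+N≤b)
    where
    a+N≤b : a ℕ.+ N ℕ.≤ b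
    a+N≤b = ℕP.≤-trans (ℕP.+-monoʳ-≤ a (ℕP.m≤n*m N (suc t)))
              (ℕP.≤-reflexive (sym (ℤP.+-injective (trans b≡a+tN
                (trans (cong (λ x → + a + x) (sym (ℤP.pos-* (suc t) N))) (sym (ℤP.pos-+ a _)))))))

close-congruent⇒≡ : ∀ N a b z → b ℕ.< a ℕ.+ N → a ℕ.< b ℕ.+ N → + b ≡ + a + z * + N → a ≡ b
close-congruent⇒≡ N a b (+ zero) _ _ b≡a+0 =
  sym (ℤP.+-injective (trans b≡a+0 (trans (cong (λ x → + a + x) (ℤP.*-zeroˡ (+ N))) (ℤP.+-identityʳ _))))
close-congruent⇒≡ N a b (+ suc t)  b<a+N _ b≡a+zN = ⊥-elim (no-positive-shift N a b t b<a+N b≡a+zN)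
close-congruent⇒≡ N a b -[1+ t ]   _ a<b+N b≡a+zN = ⊥-elim (no-positive-shift N b a t a<b+N (flip (+ b) (+ a) b≡a+zN))
  where flip : ∀ b a → b ≡ a + -[1+ t ] * + N → a ≡ b + + suc t * + N
        flip b a eq = trans (cancel a (+ suc t) (+ N)) (cong (λ x → x + + suc t * + N) (sym eq))
          where cancel : ∀ a x n → a ≡ a + (- x) * n + x * n
                cancel = ℤSolver.solve-∀

module _ (m : ℕ) where
  private
    N = suc m

  %ℕ-unique : ∀ y r q → r ℕ.< N → y ≡ + r + q * + N → y %ℕ N ≡ r
  %ℕ-unique y r q r<N y≡r+qN =
    close-congruent⇒≡ N (y %ℕ N) r (y /ℕ N - q)
      (ℕP.<-≤-trans r<N (ℕP.m≤n+m N _)) (ℕP.<-≤-trans (ℤD.n%ℕd<d y N) (ℕP.m≤n+m N r))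
      (begin
        + r                                       ≡⟨ cancel (+ r) (q * + N) ⟩
        + r + q * + N - q * + N                   ≡⟨ cong (_- q * + N) (sym y≡r+qN) ⟩
        y - q * + N                               ≡⟨ cong (_- q * + N) (ℤD.a≡a%ℕn+[a/ℕn]*n y N) ⟩
        + (y %ℕ N) + y /ℕ N * + N - q * + N       ≡⟨ collect (+ (y %ℕ N)) (y /ℕ N) q (+ N) ⟩
        + (y %ℕ N) + (y /ℕ N - q) * + N           ∎)
    where open ≡-Reasoning
          cancel : ∀ a b → a ≡ a + b - b
          cancel = ℤSolver.solve-∀
          collect : ∀ r w q n → r + w * n - q * n ≡ r + (w - q) * n
          collect = ℤSolver.solve-∀

  %ℕ-shift : ∀ y c r z → r ℕ.< N → + (y %ℕ N) + c ≡ + r + z * + N → (y + c) %ℕ N ≡ r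
  %ℕ-shift y c r z r<N eq = %ℕ-unique (y + c) r (z + y /ℕ N) r<N (begin
    y + c                                           ≡⟨ cong (_+ c) (ℤD.a≡a%ℕn+[a/ℕn]*n y N) ⟩
    + (y %ℕ N) + y /ℕ N * + N + c                   ≡⟨ swap (+ (y %ℕ N)) (y /ℕ N * + N) c ⟩
    + (y %ℕ N) + c + y /ℕ N * + N                   ≡⟨ cong (_+ y /ℕ N * + N) eq ⟩
    + r + z * + N + y /ℕ N * + N                    ≡⟨ collect (+ r) z (y /ℕ N) (+ N) ⟩
    + r + (z + y /ℕ N) * + N                        ∎)
    where open ≡-Reasoning
          swap : ∀ a b c → a + b + c ≡ a + c + b
          swap = ℤSolver.solve-∀
          collect : ∀ r z w n → r + z * n + w * n ≡ r + (z + w) * n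
          collect = ℤSolver.solve-∀

  %ℕ-+-multiple : ∀ y z → (y + z * + N) %ℕ N ≡ y %ℕ N
  %ℕ-+-multiple y z = %ℕ-shift y (z * + N) (y %ℕ N) z (ℤD.n%ℕd<d y N) refl

  %ℕ-suc : ∀ y r → y %ℕ N ≡ r → suc r ℕ.< N → (y + + 1) %ℕ N ≡ suc r
  %ℕ-suc y r y%N≡r 1+r<N = %ℕ-shift y (+ 1) (suc r) (+ 0) 1+r<N (begin
    + (y %ℕ N) + + 1          ≡⟨ cong (λ x → + x + + 1) y%N≡r ⟩
    + r + + 1                 ≡⟨ shift (+ r) (+ N) ⟩
    + suc r + + 0 * + N       ∎)
    where open ≡-Reasoning
          shift : ∀ r n → r + + 1 ≡ (+ 1 + r) + + 0 * n
          shift = ℤSolver.solve-∀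

  %ℕ-suc-wrap : ∀ y → y %ℕ N ≡ m → (y + + 1) %ℕ N ≡ 0
  %ℕ-suc-wrap y y%N≡m = %ℕ-shift y (+ 1) 0 (+ 1) (s≤s z≤n) (begin
    + (y %ℕ N) + + 1          ≡⟨ cong (λ x → + x + + 1) y%N≡m ⟩
    + m + + 1                 ≡⟨ shift (+ m) ⟩
    + 0 + + 1 * + N           ∎)
    where open ≡-Reasoning
          shift : ∀ m → m + + 1 ≡ + 0 + + 1 * (+ 1 + m)
          shift = ℤSolver.solve-∀

  %ℕ-pred : ∀ y r → y %ℕ N ≡ suc r → (y - + 1) %ℕ N ≡ r
  %ℕ-pred y r y%N≡1+r = %ℕ-shift y (- + 1) r (+ 0) r<N (begin
    + (y %ℕ N) - + 1          ≡⟨ cong (λ x → + x - + 1) y%N≡1+r ⟩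
    + suc r - + 1             ≡⟨ shift (+ r) (+ N) ⟩
    + r + + 0 * + N           ∎)
    where open ≡-Reasoning
          r<N = ℕP.<-trans (ℕP.n<1+n r) (subst (ℕ._< N) y%N≡1+r (ℤD.n%ℕd<d y N))
          shift : ∀ r n → (+ 1 + r) - + 1 ≡ r + + 0 * n
          shift = ℤSolver.solve-∀

  %ℕ-pred-wrap : ∀ y → y %ℕ N ≡ 0 → (y - + 1) %ℕ N ≡ m
  %ℕ-pred-wrap y y%N≡0 = %ℕ-shift y (- + 1) m (- + 1) (ℕP.n<1+n m) (begin
    + (y %ℕ N) - + 1          ≡⟨ cong (λ x → + x - + 1) y%N≡0 ⟩
    + 0 - + 1                 ≡⟨ shift (+ m) ⟩
    + m + (- + 1) * + N       ∎)
    where open ≡-Reasoning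
          shift : ∀ m → + 0 - + 1 ≡ m + (- + 1) * (+ 1 + m)
          shift = ℤSolver.solve-∀

  %ℕ-+-pred : ∀ y r → y %ℕ N ≡ suc r → (y + + m) %ℕ N ≡ r
  %ℕ-+-pred y r y%N≡1+r = %ℕ-shift y (+ m) r (+ 1) r<N (begin
    + (y %ℕ N) + + m          ≡⟨ cong (λ x → + x + + m) y%N≡1+r ⟩
    + suc r + + m             ≡⟨ shift (+ r) (+ m) ⟩
    + r + + 1 * + N           ∎)
    where open ≡-Reasoning
          r<N = ℕP.<-trans (ℕP.n<1+n r) (subst (ℕ._< N) y%N≡1+r (ℤD.n%ℕd<d y N))
          shift : ∀ r m → (+ 1 + r) + m ≡ r + + 1 * (+ 1 + m)
          shift = ℤSolver.solve-∀

-- Counting admissible indices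

private
  variable
    P Q B : ℕ → Set

count : (∀ i → Dec (P i)) → ℕ → ℕ
count P? zero = 0
count P? (suc n) with P? 0
... | yes _ = suc (count (P? ∘ suc) n)
... | no  _ = count (P? ∘ suc) n

count-none : ∀ (P? : ∀ i → Dec (P i)) n → (∀ i → ¬ P i) → count P? n ≡ 0
count-none P? zero    ¬P = refl
count-none P? (suc n) ¬P with P? 0
... | yes p = ⊥-elim (¬P 0 p)
... | no  _ = count-none (P? ∘ suc) n (¬P ∘ suc)

count-pos : ∀ (P? : ∀ i → Dec (P i)) n i → P i → i ℕ.< n → 1 ℕ.≤ count P? n
count-pos P? (suc n) i p i<n with P? 0
count-pos P? (suc n) i       p i<n       | yes _ = s≤s z≤n
count-pos P? (suc n) zero    p i<n       | no ¬p = ⊥-elim (¬p p)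
count-pos P? (suc n) (suc i) p (s≤s i<n) | no ¬p = count-pos (P? ∘ suc) n i p i<n

count-witness : ∀ (P? : ∀ i → Dec (P i)) n → 1 ℕ.≤ count P? n → ∃ P
count-witness P? (suc n) pos with P? 0
... | yes p = 0 , p
... | no  _ = let (i , p) = count-witness (P? ∘ suc) n pos in suc i , p

count-suc-≤ : ∀ (P? : ∀ i → Dec (P i)) n → count P? (suc n) ℕ.≤ suc (count (P? ∘ suc) n)
count-suc-≤ P? n with P? 0
... | yes _ = ℕP.≤-refl
... | no  _ = ℕP.n≤1+n _

count-suc-≥ : ∀ (P? : ∀ i → Dec (P i)) n → count (P? ∘ suc) n ℕ.≤ count P? (suc n)
count-suc-≥ P? n with P? 0
... | yes _ = ℕP.n≤1+n _
... | no  _ = ℕP.≤-refl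

count-+ : ∀ (P? : ∀ i → Dec (P i)) n t → (∀ i → P i → i ℕ.< n) → count P? (n ℕ.+ t) ≡ count P? n
count-+ P? zero    t bound = count-none P? t (λ i p → ℕP.n≮0 (bound i p))
count-+ P? (suc n) t bound with P? 0
... | yes _ = cong suc (count-+ (P? ∘ suc) n t (λ i p → ℕP.≤-pred (bound (suc i) p)))
... | no  _ = count-+ (P? ∘ suc) n t (λ i p → ℕP.≤-pred (bound (suc i) p))

count-bound-irrelevant : ∀ (P? : ∀ i → Dec (P i)) n n' → (∀ i → P i → i ℕ.< n) → (∀ i → P i → i ℕ.< n') →
                         count P? n ≡ count P? n'
count-bound-irrelevant P? n n' bound bound' with ℕP.≤-total n n'
... | inj₁ n≤n' = trans (sym (count-+ P? n (n' ℕ.∸ n) bound)) (cong (count P?) (ℕP.m+[n∸m]≡n n≤n'))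
... | inj₂ n'≤n = trans (cong (count P?) (sym (ℕP.m+[n∸m]≡n n'≤n))) (count-+ P? n' (n ℕ.∸ n') bound')

count-at-most-one : ∀ (P? : ∀ i → Dec (P i)) n → (∀ i j → P i → P j → i ≡ j) → count P? n ℕ.≤ 1
count-at-most-one P? zero    unique = z≤n
count-at-most-one P? (suc n) unique with P? 0
... | yes p0 = s≤s (ℕP.≤-reflexive (count-none (P? ∘ suc) n (λ i pi → ℕP.0≢1+n (unique 0 (suc i) p0 pi))))
... | no  _  = count-at-most-one (P? ∘ suc) n (λ i j pi pj → ℕP.suc-injective (unique (suc i) (suc j) pi pj))

greatest : ∀ (P? : ∀ i → Dec (P i)) b → (∀ i → P i → i ℕ.≤ b) → ∃ P → ∃ λ m → P m × (∀ i → P i → i ℕ.≤ m)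
greatest P? zero    bound (i , p) with bound i p
... | z≤n = 0 , p , bound
greatest P? (suc b) bound (i , p) with P? (suc b)
... | yes pb = suc b , pb , bound
... | no ¬pb = greatest P? b (λ j pj → ℕP.≤-pred (ℕP.≤∧≢⇒< (bound j pj) (λ { refl → ¬pb pj }))) (i , p)

count-mono : ∀ (P? : ∀ i → Dec (P i)) (Q? : ∀ i → Dec (Q i)) n → (∀ i → P i → Q i) → count P? n ℕ.≤ count Q? n
count-mono P? Q? zero    P⊆Q = z≤n
count-mono P? Q? (suc n) P⊆Q with P? 0 | Q? 0
... | yes p | yes _ = s≤s (count-mono (P? ∘ suc) (Q? ∘ suc) n (P⊆Q ∘ suc))
... | yes p | no ¬q = ⊥-elim (¬q (P⊆Q 0 p))
... | no  _ | yes _ = ℕP.m≤n⇒m≤1+n (count-mono (P? ∘ suc) (Q? ∘ suc) n (P⊆Q ∘ suc))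
... | no  _ | no  _ = count-mono (P? ∘ suc) (Q? ∘ suc) n (P⊆Q ∘ suc)

count-cong : ∀ (P? : ∀ i → Dec (P i)) (Q? : ∀ i → Dec (Q i)) n → (∀ i → P i → Q i) → (∀ i → Q i → P i) →
             count P? n ≡ count Q? n
count-cong P? Q? n P⊆Q Q⊆P = ℕP.≤-antisym (count-mono P? Q? n P⊆Q) (count-mono Q? P? n Q⊆P)

count-strict : ∀ (P? : ∀ i → Dec (P i)) (Q? : ∀ i → Dec (Q i)) n i₀ →
               (∀ i → Q i → P i) → P i₀ → ¬ Q i₀ → i₀ ℕ.< n → count Q? n ℕ.< count P? n
count-strict P? Q? (suc n) zero Q⊆P p ¬q _ with P? 0 | Q? 0
... | yes _ | yes q = ⊥-elim (¬q q)
... | yes _ | no  _ = s≤s (count-mono (Q? ∘ suc) (P? ∘ suc) n (Q⊆P ∘ suc))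
... | no ¬p | _     = ⊥-elim (¬p p)
count-strict P? Q? (suc n) (suc i₀) Q⊆P p ¬q (s≤s i₀<n) with P? 0 | Q? 0
... | yes _ | yes _ = s≤s (count-strict (P? ∘ suc) (Q? ∘ suc) n i₀ (Q⊆P ∘ suc) p ¬q i₀<n)
... | yes _ | no  _ = ℕP.m≤n⇒m≤1+n (count-strict (P? ∘ suc) (Q? ∘ suc) n i₀ (Q⊆P ∘ suc) p ¬q i₀<n)
... | no ¬p | yes q = ⊥-elim (¬p (Q⊆P 0 q))
... | no  _ | no  _ = count-strict (P? ∘ suc) (Q? ∘ suc) n i₀ (Q⊆P ∘ suc) p ¬q i₀<n

count-⊆-∪ : ∀ (P? : ∀ i → Dec (P i)) (Q? : ∀ i → Dec (Q i)) (B? : ∀ i → Dec (B i)) n →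
            (∀ i → P i → Q i ⊎ B i) → count P? n ℕ.≤ count Q? n ℕ.+ count B? n
count-⊆-∪ P? Q? B? zero    P⊆Q∪B = z≤n
count-⊆-∪ P? Q? B? (suc n) P⊆Q∪B with P? 0 | Q? 0 | B? 0 | count-⊆-∪ (P? ∘ suc) (Q? ∘ suc) (B? ∘ suc) n (P⊆Q∪B ∘ suc)
... | yes _ | yes _ | yes _ | IH = s≤s (ℕP.≤-trans IH (ℕP.+-monoʳ-≤ (count (Q? ∘ suc) n) (ℕP.n≤1+n _)))
... | yes _ | yes _ | no  _ | IH = s≤s IH
... | yes _ | no  _ | yes _ | IH = ℕP.≤-trans (s≤s IH) (ℕP.≤-reflexive (sym (ℕP.+-suc _ _)))
... | yes p | no ¬q | no ¬b | _  = ⊥-elim ([ ¬q , ¬b ] (P⊆Q∪B 0 p))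
... | no  _ | yes _ | yes _ | IH = ℕP.m≤n⇒m≤1+n (ℕP.≤-trans IH (ℕP.+-monoʳ-≤ (count (Q? ∘ suc) n) (ℕP.n≤1+n _)))
... | no  _ | yes _ | no  _ | IH = ℕP.m≤n⇒m≤1+n IH
... | no  _ | no  _ | yes _ | IH = ℕP.≤-trans IH (ℕP.≤-trans (ℕP.n≤1+n _) (ℕP.≤-reflexive (sym (ℕP.+-suc _ _))))
... | no  _ | no  _ | no  _ | IH = IH

length-filter-applyUpTo : ∀ {A : Set} {R : A → Set} (R? : ∀ a → Dec (R a)) (f : ℕ → A) n →
                          length (filter R? (applyUpTo f n)) ≡ count (R? ∘ f) n
length-filter-applyUpTo R? f zero = refl
length-filter-applyUpTo R? f (suc n) with R? (f 0)
... | yes _ = cong suc (length-filter-applyUpTo R? (f ∘ suc) n)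
... | no  _ = length-filter-applyUpTo R? (f ∘ suc) n

-- Distance to a set of divisors

Decrement : ∀ {n} → Divisor n → Fin n → Divisor n → Set
Decrement d v d' = d' v ≡ d v - + 1 × (∀ u → u ≢ v → d' u ≡ d u)

Adjacent : ∀ {n} → Divisor n → Divisor n → Set
Adjacent d d' = ∃ λ v → Decrement d v d' ⊎ Decrement d' v d

decrementAt : ∀ {n} (d : Divisor n) v → Decrement d v (updateAt d v (_- + 1))
decrementAt d v = updateAt-updates v d , λ u u≢v → updateAt-minimal u v d u≢v

incrementAt : ∀ {n} (d : Divisor n) v → Decrement (updateAt d v (_+ + 1)) v d
incrementAt d v = trans (cancel (d v)) (cong (_- + 1) (sym (updateAt-updates v d)))
                , λ u u≢v → sym (updateAt-minimal u v d u≢v)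
  where cancel : ∀ a → a ≡ a + + 1 - + 1
        cancel = ℤSolver.solve-∀

deg-decrement : ∀ {n} {d d' : Divisor n} {v} → Decrement d v d' → deg d' ≡ deg d - + 1
deg-decrement {n} {d} {d'} {v} (d'v≡dv-1 , agree) = begin
  deg d'                     ≡⟨ cancel (deg d') (d v) ⟩
  deg d' + d v - d v         ≡⟨ cong (_- d v) (sumℤ-exchange n d' d v agree) ⟩
  deg d + d' v - d v         ≡⟨ cong (λ x → deg d + x - d v) d'v≡dv-1 ⟩
  deg d + (d v - + 1) - d v  ≡⟨ cancel′ (deg d) (d v) ⟩
  deg d - + 1                ∎
  where open ≡-Reasoning
        cancel : ∀ a x → a ≡ a + x - x
        cancel = ℤSolver.solve-∀
        cancel′ : ∀ a x → a + (x - + 1) - x ≡ a - + 1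
        cancel′ = ℤSolver.solve-∀

dist₁-refl : ∀ {n} (d : Divisor n) → dist₁ d d ≡ 0
dist₁-refl {n} d = trans (sumℕ-cong n (λ u → cong ∣_∣ (ℤP.+-inverseʳ (d u)))) (sumℕ-zeros n)
  where sumℕ-zeros : ∀ n → sumℕ n (λ _ → 0) ≡ 0
        sumℕ-zeros zero    = refl
        sumℕ-zeros (suc n) = sumℕ-zeros n

dist₁≡0⇒≗ : ∀ {n} (d d' : Divisor n) → dist₁ d d' ≡ 0 → ∀ u → d u ≡ d' u
dist₁≡0⇒≗ {n} d d' dist≡0 u = ℤP.i-j≡0⇒i≡j (d u) (d' u) (ℤP.∣i∣≡0⇒i≡0 (sumℕ≡0⇒≡0 n _ dist≡0 u))

dist₁-exchange : ∀ {n} (x d d' : Divisor n) v → (∀ u → u ≢ v → d u ≡ d' u) →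
                 dist₁ x d ℕ.+ ∣ x v - d' v ∣ ≡ dist₁ x d' ℕ.+ ∣ x v - d v ∣
dist₁-exchange {n} x d d' v agree = sumℕ-exchange n _ _ v (λ u u≢v → cong (λ y → ∣ x u - y ∣) (agree u u≢v))

dist₁-decrement : ∀ {n} {d d' : Divisor n} {v} x → Decrement d v d' → dist₁ d x ℕ.≤ suc (dist₁ d' x)
dist₁-decrement {n} {d} {d'} {v} x (d'v≡dv-1 , agree) = ℕP.+-cancelʳ-≤ ∣ d' v - x v ∣ _ _ (begin
  dist₁ d x ℕ.+ ∣ d' v - x v ∣          ≡⟨ sumℕ-exchange n _ _ v (λ u u≢v → cong (λ y → ∣ y - x u ∣) (sym (agree u u≢v))) ⟩
  dist₁ d' x ℕ.+ ∣ d v - x v ∣          ≤⟨ ℕP.+-monoʳ-≤ (dist₁ d' x) dv-xv≤ ⟩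
  dist₁ d' x ℕ.+ (∣ d' v - x v ∣ ℕ.+ 1) ≡⟨ ℕP.+-comm (dist₁ d' x) _ ⟩
  ∣ d' v - x v ∣ ℕ.+ 1 ℕ.+ dist₁ d' x   ≡⟨ cong (ℕ._+ dist₁ d' x) (ℕP.+-comm _ 1) ⟩
  suc (∣ d' v - x v ∣ ℕ.+ dist₁ d' x)   ≡⟨ cong suc (ℕP.+-comm _ (dist₁ d' x)) ⟩
  suc (dist₁ d' x) ℕ.+ ∣ d' v - x v ∣   ∎)
  where
  open ℕP.≤-Reasoning
  dv-xv≤ : ∣ d v - x v ∣ ℕ.≤ ∣ d' v - x v ∣ ℕ.+ 1
  dv-xv≤ = subst (λ y → ∣ y ∣ ℕ.≤ _) (trans (cong (λ y → y - x v + + 1) d'v≡dv-1) (shuffle (d v) (x v)))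
                 (ℤP.∣i+j∣≤∣i∣+∣j∣ (d' v - x v) (+ 1))
    where shuffle : ∀ a b → a - + 1 - b + + 1 ≡ a - b
          shuffle = ℤSolver.solve-∀

dist₁-closer : ∀ {n} (x d d'' : Divisor n) v t → dist₁ x d ≡ suc t → (∀ u → u ≢ v → d'' u ≡ d u) →
               ∣ x v - d v ∣ ≡ suc ∣ x v - d'' v ∣ → dist₁ x d'' ≡ t
dist₁-closer x d d'' v t dist≡1+t agree closer = ℕP.+-cancelʳ-≡ (suc ∣ x v - d'' v ∣) _ _ (begin
  dist₁ x d'' ℕ.+ suc ∣ x v - d'' v ∣  ≡⟨ cong (dist₁ x d'' ℕ.+_) (sym closer) ⟩
  dist₁ x d'' ℕ.+ ∣ x v - d v ∣        ≡⟨ dist₁-exchange x d'' d v agree ⟩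
  dist₁ x d ℕ.+ ∣ x v - d'' v ∣        ≡⟨ cong (ℕ._+ ∣ x v - d'' v ∣) dist≡1+t ⟩
  suc t ℕ.+ ∣ x v - d'' v ∣            ≡⟨ ℕP.+-suc t _ ⟨
  t ℕ.+ suc ∣ x v - d'' v ∣            ∎)
  where open ≡-Reasoning

step-towards : ∀ {n} (x d : Divisor n) t → dist₁ x d ≡ suc t → ∃ λ d'' → Adjacent d d'' × dist₁ x d'' ≡ t
step-towards {n} x d t dist≡1+t with sumℕ≢0⇒∃≢0 n (λ u → ∣ x u - d u ∣) t dist≡1+t
... | v , _ , xv-dv≢0 with x v - d v in xv-dv
... | + zero   = ⊥-elim (ℕP.0≢1+n xv-dv≢0)
... | + suc w  = d'' , (v , inj₂ (incrementAt d v)) ,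
                 dist₁-closer x d d'' v t dist≡1+t (λ u u≢v → updateAt-minimal u v d u≢v)
                   (trans (cong ∣_∣ xv-dv) (cong (suc ∘ ∣_∣) (sym xv-d''v≡w)))
  where
  d'' = updateAt d v (_+ + 1)
  xv-d''v≡w : x v - d'' v ≡ + w
  xv-d''v≡w = begin
    x v - d'' v         ≡⟨ cong (λ y → x v - y) (updateAt-updates v d) ⟩
    x v - (d v + + 1)   ≡⟨ shuffle (x v) (d v) ⟩
    x v - d v - + 1     ≡⟨ cong (_- + 1) xv-dv ⟩
    + w                 ∎
    where open ≡-Reasoning
          shuffle : ∀ a b → a - (b + + 1) ≡ a - b - + 1
          shuffle = ℤSolver.solve-∀
... | -[1+ w ] = d'' , (v , inj₁ (decrementAt d v)) ,
                 dist₁-closer x d d'' v t dist≡1+t (λ u u≢v → updateAt-minimal u v d u≢v)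
                   (trans (cong ∣_∣ xv-dv) (cong suc (sym (trans (cong ∣_∣ xv-d''v≡-w) (ℤP.∣-i∣≡∣i∣ (+ w))))))
  where
  d'' = updateAt d v (_- + 1)
  -[1+w]+1≡-w : ∀ w → -[1+ w ] + + 1 ≡ - + w
  -[1+w]+1≡-w zero    = refl
  -[1+w]+1≡-w (suc w) = refl
  xv-d''v≡-w : x v - d'' v ≡ - + w
  xv-d''v≡-w = begin
    x v - d'' v         ≡⟨ cong (λ y → x v - y) (updateAt-updates v d) ⟩
    x v - (d v - + 1)   ≡⟨ shuffle (x v) (d v) ⟩
    x v - d v + + 1     ≡⟨ cong (_+ + 1) xv-dv ⟩
    -[1+ w ] + + 1      ≡⟨ -[1+w]+1≡-w w ⟩
    - + w               ∎
    where open ≡-Reasoning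
          shuffle : ∀ a b → a - (b - + 1) ≡ a - b + + 1
          shuffle = ℤSolver.solve-∀

module DistanceByDescent {n} (Z : Divisor n → Set) (ρ : Divisor n → ℕ)
  (ρ-cong : ∀ d d' → (∀ u → d u ≡ d' u) → ρ d ≡ ρ d')
  (Z⇒ρ≡0 : ∀ d → Z d → ρ d ≡ 0)
  (ρ≡0⇒Z : ∀ d → ρ d ≡ 0 → Z d)
  (ρ-adjacent : ∀ d d' → Adjacent d d' → ρ d' ℕ.≤ suc (ρ d))
  (ρ-descent : ∀ d → 1 ℕ.≤ ρ d → ∃ λ v → ∃ λ d' → Decrement d v d' × ρ d' ℕ.< ρ d)
  where

  ρ-≤-ρ+dist₁ : ∀ t d d' → dist₁ d d' ≡ t → ρ d ℕ.≤ ρ d' ℕ.+ t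
  ρ-≤-ρ+dist₁ zero d d' dist≡0 = ℕP.≤-reflexive (trans (ρ-cong d d' (dist₁≡0⇒≗ d d' dist≡0)) (sym (ℕP.+-identityʳ _)))
  ρ-≤-ρ+dist₁ (suc t) d d' dist≡1+t with step-towards d d' t dist≡1+t
  ... | d'' , d'~d'' , dist≡t = begin
    ρ d                  ≤⟨ ρ-≤-ρ+dist₁ t d d'' dist≡t ⟩
    ρ d'' ℕ.+ t          ≤⟨ ℕP.+-monoˡ-≤ t (ρ-adjacent d' d'' d'~d'') ⟩
    suc (ρ d') ℕ.+ t     ≡⟨ ℕP.+-suc (ρ d') t ⟨
    ρ d' ℕ.+ suc t       ∎
    where open ℕP.≤-Reasoning

  ρ-≤-dist₁ : ∀ d d' → Z d' → ρ d ℕ.≤ dist₁ d d'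
  ρ-≤-dist₁ d d' z = subst (λ r → ρ d ℕ.≤ r ℕ.+ dist₁ d d') (Z⇒ρ≡0 d' z) (ρ-≤-ρ+dist₁ _ d d' refl)

  dist₁-≤-ρ : ∀ bound d → ρ d ℕ.≤ bound → ∃ λ d' → Z d' × dist₁ d d' ℕ.≤ ρ d
  dist₁-≤-ρ bound d ρd≤bound with ρ d ℕ.≟ 0
  ... | yes ρd≡0 = d , ρ≡0⇒Z d ρd≡0 , ℕP.≤-trans (ℕP.≤-reflexive (dist₁-refl d)) z≤n
  dist₁-≤-ρ zero        d ρd≤0 | no ρd≢0 = ⊥-elim (ρd≢0 (ℕP.n≤0⇒n≡0 ρd≤0))
  dist₁-≤-ρ (suc bound) d ρd≤1+b | no ρd≢0 with ρ-descent d (ℕP.n≢0⇒n>0 ρd≢0)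
  ... | v , d'' , d↘d'' , ρd''<ρd with dist₁-≤-ρ bound d'' (ℕP.≤-pred (ℕP.<-≤-trans ρd''<ρd ρd≤1+b))
  ... | d' , z , dist''≤ρ'' = d' , z , (begin
    dist₁ d d'         ≤⟨ dist₁-decrement d' d↘d'' ⟩
    suc (dist₁ d'' d') ≤⟨ s≤s dist''≤ρ'' ⟩
    suc (ρ d'')        ≤⟨ ρd''<ρd ⟩
    ρ d                ∎)
    where open ℕP.≤-Reasoning

  ρ-is-dist₁ : ∀ d → (∃ λ d' → Z d' × dist₁ d d' ≡ ρ d) × (∀ d' → Z d' → ρ d ℕ.≤ dist₁ d d')
  ρ-is-dist₁ d with dist₁-≤-ρ (ρ d) d ℕP.≤-refl
  ... | d' , z , dist≤ρ = (d' , z , ℕP.≤-antisym dist≤ρ (ρ-≤-dist₁ d d' z)) , ρ-≤-dist₁ d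

-- The complete graph

vₙ : (k : ℕ) → Fin (suc (suc k))
vₙ k = fromℕ (suc k)

private
  toℕ-vtx : ∀ {k} (j : Fin k) → toℕ (vtx j) ≡ toℕ j
  toℕ-vtx j = trans (FP.toℕ-inject₁ (inject₁ j)) (FP.toℕ-inject₁ j)

  toℕ-vₙ₋₁ : ∀ k → toℕ (vₙ₋₁ k) ≡ k
  toℕ-vₙ₋₁ k = trans (FP.toℕ-inject₁ (fromℕ k)) (FP.toℕ-fromℕ k)

vtx≢vₙ₋₁ : ∀ {k} (j : Fin k) → vtx j ≢ vₙ₋₁ k
vtx≢vₙ₋₁ {k} j eq = ℕP.<-irrefl (trans (sym (toℕ-vtx j)) (trans (cong toℕ eq) (toℕ-vₙ₋₁ k))) (FP.toℕ<n j)

vtx≢vₙ : ∀ {k} (j : Fin k) → vtx j ≢ vₙ k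
vtx≢vₙ {k} j eq = ℕP.<-irrefl (trans (sym (toℕ-vtx j)) (trans (cong toℕ eq) (FP.toℕ-fromℕ (suc k)))) (ℕP.m<n⇒m<1+n (FP.toℕ<n j))

vₙ₋₁≢vₙ : ∀ k → vₙ₋₁ k ≢ vₙ k
vₙ₋₁≢vₙ k eq = ℕP.<-irrefl (trans (sym (toℕ-vₙ₋₁ k)) (trans (cong toℕ eq) (FP.toℕ-fromℕ (suc k)))) (ℕP.n<1+n k)

vtx-injective : ∀ {k} {j j' : Fin k} → vtx j ≡ vtx j' → j ≡ j'
vtx-injective = FP.inject₁-injective ∘ FP.inject₁-injective

vertex-cases : ∀ k (v : Fin (suc (suc k))) → (∃ λ j → v ≡ vtx j) ⊎ v ≡ vₙ₋₁ k ⊎ v ≡ vₙ k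
vertex-cases zero    zero       = inj₂ (inj₁ refl)
vertex-cases zero    (suc zero) = inj₂ (inj₂ refl)
vertex-cases (suc k) zero       = inj₁ (zero , refl)
vertex-cases (suc k) (suc v) with vertex-cases k v
... | inj₁ (j , refl) = inj₁ (suc j , refl)
... | inj₂ (inj₁ refl) = inj₂ (inj₁ refl)
... | inj₂ (inj₂ refl) = inj₂ (inj₂ refl)

glue : ∀ k {A : Set} → (Fin k → A) → A → A → Fin (suc (suc k)) → A
glue zero    f a b zero    = a
glue zero    f a b (suc _) = b
glue (suc k) f a b zero    = f zero
glue (suc k) f a b (suc v) = glue k (f ∘ suc) a b v

glue-vtx : ∀ k {A : Set} (f : Fin k → A) a b j → glue k f a b (vtx j) ≡ f j
glue-vtx (suc k) f a b zero    = refl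
glue-vtx (suc k) f a b (suc j) = glue-vtx k (f ∘ suc) a b j

glue-vₙ₋₁ : ∀ k {A : Set} (f : Fin k → A) a b → glue k f a b (vₙ₋₁ k) ≡ a
glue-vₙ₋₁ zero    f a b = refl
glue-vₙ₋₁ (suc k) f a b = glue-vₙ₋₁ k (f ∘ suc) a b

glue-vₙ : ∀ k {A : Set} (f : Fin k → A) a b → glue k f a b (vₙ k) ≡ b
glue-vₙ zero    f a b = refl
glue-vₙ (suc k) f a b = glue-vₙ k (f ∘ suc) a b

deg-split : ∀ k (d : Divisor (suc (suc k))) → deg d ≡ sumℤ k (d ∘ vtx) + d (vₙ₋₁ k) + d (vₙ k)
deg-split k d = trans (sumℤ-last (suc k) d) (cong (_+ d (vₙ k)) (sumℤ-last k (d ∘ inject₁)))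

laplacian-K : ∀ n (x : Divisor n) u → laplacian (K n) x u ≡ x u * + n - sumℤ n x
laplacian-K n x u = begin
  laplacian (K n) x u                          ≡⟨ sumℤ-cong n adj-term ⟩
  sumℤ n (λ j → x u + - x j)                   ≡⟨ sumℤ-distrib-+ n (λ _ → x u) (-_ ∘ x) ⟩
  sumℤ n (λ _ → x u) + sumℤ n (-_ ∘ x)         ≡⟨ cong₂ _+_ (trans (sumℤ-const n (x u)) (ℤP.*-comm (+ n) (x u))) (sumℤ-distrib-neg n x) ⟩
  x u * + n - sumℤ n x                         ∎
  where
  open ≡-Reasoning
  adj-term : ∀ j → + Kadj u j * (x u - x j) ≡ x u - x j
  adj-term j with u F.≟ j
  ... | yes refl = trans (ℤP.*-zeroˡ (x u - x u)) (sym (ℤP.+-inverseʳ (x u)))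
  ... | no  _    = ℤP.*-identityˡ (x u - x j)

laplacian-K-image : ∀ m (w y : Divisor (suc m)) c → (∀ u → w u ≡ c + y u * + suc m) → deg w ≡ + 0 →
                    ∀ u → w u ≡ laplacian (K (suc m)) y u
laplacian-K-image m w y c w≡c+ny deg≡0 u = begin
  w u                                    ≡⟨ w≡c+ny u ⟩
  c + y u * + n                          ≡⟨ regroup c (y u * + n) (sumℤ n y) ⟩
  y u * + n - sumℤ n y + (c + sumℤ n y)  ≡⟨ cong (λ x → y u * + n - sumℤ n y + x) c+Σy≡0 ⟩
  y u * + n - sumℤ n y + + 0             ≡⟨ ℤP.+-identityʳ _ ⟩
  y u * + n - sumℤ n y                   ≡⟨ laplacian-K n y u ⟨
  laplacian (K n) y u                    ∎
  where
  open ≡-Reasoning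
  n = suc m
  regroup : ∀ c a s → c + a ≡ a - s + (c + s)
  regroup = ℤSolver.solve-∀
  expand : ∀ c s n → (c + s) * n ≡ n * c + s * n
  expand = ℤSolver.solve-∀
  n[c+Σy]≡0 : (c + sumℤ n y) * + n ≡ + 0 * + n
  n[c+Σy]≡0 = begin
    (c + sumℤ n y) * + n                     ≡⟨ expand c (sumℤ n y) (+ n) ⟩
    + n * c + sumℤ n y * + n                 ≡⟨ cong₂ _+_ (sumℤ-const n c) (sumℤ-*ʳ n y (+ n)) ⟨
    sumℤ n (λ _ → c) + sumℤ n (λ u → y u * + n) ≡⟨ sumℤ-distrib-+ n (λ _ → c) (λ u → y u * + n) ⟨
    sumℤ n (λ u → c + y u * + n)             ≡⟨ sumℤ-cong n (sym ∘ w≡c+ny) ⟩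
    deg w                                    ≡⟨ deg≡0 ⟩
    + 0 * + n                                ∎
  c+Σy≡0 : c + sumℤ n y ≡ + 0
  c+Σy≡0 = ℤP.*-cancelʳ-≡ (c + sumℤ n y) (+ 0) (+ n) n[c+Σy]≡0

i≤j-k⇒i+k≤j : ∀ i j k → i ℤ.≤ j - k → i + k ℤ.≤ j
i≤j-k⇒i+k≤j i j k i≤j-k = subst (i + k ℤ.≤_) (cancel j k) (ℤP.+-monoˡ-≤ k i≤j-k)
  where cancel : ∀ j k → j - k + k ≡ j
        cancel = ℤSolver.solve-∀

i+k≤j⇒i≤j-k : ∀ i j k → i + k ℤ.≤ j → i ℤ.≤ j - k
i+k≤j⇒i≤j-k i j k i+k≤j = subst (ℤ._≤ j - k) (cancel i k) (ℤP.+-monoˡ-≤ (- k) i+k≤j)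
  where cancel : ∀ i k → i + k - k ≡ i
        cancel = ℤSolver.solve-∀

countLe≡count : ∀ D (L R : ℕ → ℤ) M → (∀ i → L i ℤ.≤ R i → + i ℤ.≤ D) → (∀ i → L i ℤ.≤ R i → i ℕ.< M) →
                countLe D L R ≡ count (λ i → L i ℤ.≤? R i) M
countLe≡count (+ m) L R M ≤D <M = trans (length-filter-applyUpTo (λ i → L i ℤ.≤? R i) (λ i → i) (suc m))
  (count-bound-irrelevant _ (suc m) M (λ i Li≤Ri → s≤s (ℤP.drop‿+≤+ (≤D i Li≤Ri))) <M)
countLe≡count -[1+ m ] L R M ≤D <M = sym (count-none _ M (λ i Li≤Ri → ¬+≤- (≤D i Li≤Ri)))
  where ¬+≤- : ∀ {i} → + i ℤ.≤ -[1+ m ] → ⊥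
        ¬+≤- ()

countLe-cong : ∀ D {L L' : ℕ → ℤ} R → (∀ i → L i ≡ L' i) → countLe D L R ≡ countLe D L' R
countLe-cong D {L} {L'} R L≗L' = cong length (filter-≐ (λ i → L i ℤ.≤? R i) (λ i → L' i ℤ.≤? R i)
  ((λ {i} → subst (ℤ._≤ R i) (L≗L' i)) , (λ {i} → subst (ℤ._≤ R i) (sym (L≗L' i)))) (range D))

module CompleteGraph (k : ℕ) where

  N : ℕ
  N = suc (suc k)

  shifted : Divisor N → ℕ → Fin k → ℤ
  shifted d i j = d (vtx j) - d (vₙ₋₁ k) + + i

  residue : Divisor N → ℕ → Fin k → ℕ
  residue d i j = shifted d i j %ℕ N

  residueSum : Divisor N → ℕ → ℕ
  residueSum d i = sumℕ k (residue d i)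

  Admissible : Divisor N → ℕ → Set
  Admissible d i = + residueSum d i ℤ.≤ deg d - + i

  Admissible? : ∀ d i → Dec (Admissible d i)
  Admissible? d i = + residueSum d i ℤ.≤? deg d - + i

  ρ : Divisor N → ℕ
  ρ d = countLe (deg d) (λ i → + residueSum d i) (λ i → deg d - + i)

  Admissible⇒≤deg : ∀ d i → Admissible d i → + (residueSum d i ℕ.+ i) ℤ.≤ deg d
  Admissible⇒≤deg d i good = subst (ℤ._≤ deg d) (sym (ℤP.pos-+ _ i)) (i≤j-k⇒i+k≤j _ (deg d) (+ i) good)

  ≤deg⇒Admissible : ∀ d i → + (residueSum d i ℕ.+ i) ℤ.≤ deg d → Admissible d i
  ≤deg⇒Admissible d i ≤deg = i+k≤j⇒i≤j-k _ (deg d) (+ i) (subst (ℤ._≤ deg d) (ℤP.pos-+ _ i) ≤deg)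

  Admissible⇒i≤deg : ∀ d i → Admissible d i → + i ℤ.≤ deg d
  Admissible⇒i≤deg d i good = ℤP.≤-trans (ℤ.+≤+ (ℕP.m≤n+m i _)) (Admissible⇒≤deg d i good)

  Admissible⇒<bound : ∀ d M → ∣ deg d ∣ ℕ.< M → ∀ i → Admissible d i → i ℕ.< M
  Admissible⇒<bound d M ∣deg∣<M i good = bound (deg d) (Admissible⇒i≤deg d i good) ∣deg∣<M
    where bound : ∀ D → + i ℤ.≤ D → ∣ D ∣ ℕ.< M → i ℕ.< M
          bound (+ m) (ℤ.+≤+ i≤m) = ℕP.≤-<-trans i≤m

  ρ≡count : ∀ d M → ∣ deg d ∣ ℕ.< M → ρ d ≡ count (Admissible? d) M
  ρ≡count d M ∣deg∣<M = countLe≡count (deg d) _ _ M (Admissible⇒i≤deg d) (Admissible⇒<bound d M ∣deg∣<M)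

  ρ-cong : ∀ d d' → (∀ u → d u ≡ d' u) → ρ d ≡ ρ d'
  ρ-cong d d' d≗d' = begin
    ρ d                        ≡⟨ ρ≡count d M (ℕP.n<1+n _) ⟩
    count (Admissible? d) M    ≡⟨ count-cong (Admissible? d) (Admissible? d') M (λ i → subst₂ (≤deg-i i) (S≡ i) deg≡)
                                                                              (λ i → subst₂ (≤deg-i i) (sym (S≡ i)) (sym deg≡)) ⟩
    count (Admissible? d') M   ≡⟨ ρ≡count d' M (subst (λ D → ∣ D ∣ ℕ.< M) deg≡ (ℕP.n<1+n _)) ⟨
    ρ d'                       ∎
    where
    open ≡-Reasoning
    M = suc ∣ deg d ∣
    deg≡ : deg d ≡ deg d'
    deg≡ = sumℤ-cong N d≗d'
    S≡ : ∀ i → residueSum d i ≡ residueSum d' i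
    S≡ i = sumℕ-cong k (λ j → cong₂ (λ a b → (a - b + + i) %ℕ N) (d≗d' (vtx j)) (d≗d' (vₙ₋₁ k)))
    ≤deg-i : ℕ → ℕ → ℤ → Set
    ≤deg-i i s D = + s ℤ.≤ D - + i

  private
    p q : Fin N
    p = vₙ₋₁ k
    q = vₙ k

  deg-∼ : ∀ {d e} → d ∼⟨ K N ⟩ e → deg d ≡ deg e
  deg-∼ {d} {e} (y , d-e≡Δy) = begin
    deg d
        ≡⟨ sumℤ-cong N (λ u → trans (split (d u) (e u)) (cong (λ x → e u + x) (trans (d-e≡Δy u) (laplacian-K N y u)))) ⟩
    sumℤ N (λ u → e u + (y u * + N - sumℤ N y))       ≡⟨ sumℤ-distrib-+ N e (λ u → y u * + N + - sumℤ N y) ⟩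
    deg e + sumℤ N (λ u → y u * + N + - sumℤ N y)     ≡⟨ cong (λ x → deg e + x) (sumℤ-distrib-+ N (λ u → y u * + N) (λ _ → - sumℤ N y)) ⟩
    deg e + (sumℤ N (λ u → y u * + N) + sumℤ N (λ _ → - sumℤ N y))
                                                      ≡⟨ cong (λ x → deg e + x) (cong₂ _+_ (sumℤ-*ʳ N y (+ N)) (sumℤ-const N _)) ⟩
    deg e + (sumℤ N y * + N + + N * - sumℤ N y)       ≡⟨ cancel (deg e) (sumℤ N y) (+ N) ⟩
    deg e                                             ∎
    where
    open ≡-Reasoning
    split : ∀ a b → a ≡ b + (a - b)
    split = ℤSolver.solve-∀
    cancel : ∀ a s n → a + (s * n + n * - s) ≡ a
    cancel = ℤSolver.solve-∀

  residue≤chips : ∀ {d e} → Nonneg e → d ∼⟨ K N ⟩ e → ∀ j → residue d ∣ e p ∣ j ℕ.≤ ∣ e (vtx j) ∣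
  residue≤chips {d} {e} e≥0 (y , d-e≡Δy) j =
    subst (ℕ._≤ ∣ e (vtx j) ∣) (sym (trans (cong (_%ℕ N) shifted≡) (%ℕ-+-multiple (suc k) (+ ∣ e (vtx j) ∣) (y (vtx j) - y p))))
          (ℕD.m%n≤m ∣ e (vtx j) ∣ N)
    where
    open ≡-Reasoning
    Δ : ∀ u → d u - e u ≡ y u * + N - sumℤ N y
    Δ u = trans (d-e≡Δy u) (laplacian-K N y u)
    ∣e∣≡e : ∀ u → + ∣ e u ∣ ≡ e u
    ∣e∣≡e u = ℤP.0≤i⇒+∣i∣≡i (e≥0 u)
    regroup : ∀ a b c d → a - b + d ≡ c + (a - c) - (b - d)
    regroup = ℤSolver.solve-∀
    collect : ∀ c yj yp s n → c + (yj * n - s) - (yp * n - s) ≡ c + (yj - yp) * n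
    collect = ℤSolver.solve-∀
    shifted≡ : shifted d ∣ e p ∣ j ≡ + ∣ e (vtx j) ∣ + (y (vtx j) - y p) * + N
    shifted≡ = begin
      d (vtx j) - d p + + ∣ e p ∣                              ≡⟨ cong (λ x → d (vtx j) - d p + x) (∣e∣≡e p) ⟩
      d (vtx j) - d p + e p                                    ≡⟨ regroup (d (vtx j)) (d p) (e (vtx j)) (e p) ⟩
      e (vtx j) + (d (vtx j) - e (vtx j)) - (d p - e p)        ≡⟨ cong₂ (λ a b → e (vtx j) + a - b) (Δ (vtx j)) (Δ p) ⟩
      e (vtx j) + (y (vtx j) * + N - sumℤ N y) - (y p * + N - sumℤ N y)
                                                               ≡⟨ collect (e (vtx j)) (y (vtx j)) (y p) (sumℤ N y) (+ N) ⟩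
      e (vtx j) + (y (vtx j) - y p) * + N                      ≡⟨ cong (λ x → x + (y (vtx j) - y p) * + N) (∣e∣≡e (vtx j)) ⟨
      + ∣ e (vtx j) ∣ + (y (vtx j) - y p) * + N                ∎

  Nonneg⇒Admissible : ∀ {d e} → Nonneg e → d ∼⟨ K N ⟩ e → Admissible d ∣ e p ∣
  Nonneg⇒Admissible {d} {e} e≥0 d∼e = ≤deg⇒Admissible d _ (begin
    + (residueSum d ∣ e p ∣ ℕ.+ ∣ e p ∣)    ≤⟨ ℤ.+≤+ (ℕP.+-monoˡ-≤ ∣ e p ∣ (sumℕ-mono-≤ k (residue≤chips {d} {e} e≥0 d∼e))) ⟩
    + (Σe ℕ.+ ∣ e p ∣)                      ≤⟨ ℤ.+≤+ (ℕP.m≤m+n (Σe ℕ.+ ∣ e p ∣) ∣ e q ∣) ⟩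
    + (Σe ℕ.+ ∣ e p ∣ ℕ.+ ∣ e q ∣)           ≡⟨ trans (ℤP.pos-+ (Σe ℕ.+ ∣ e p ∣) ∣ e q ∣) (cong (_+ + ∣ e q ∣) (ℤP.pos-+ Σe ∣ e p ∣)) ⟩
    + Σe + + ∣ e p ∣ + + ∣ e q ∣             ≡⟨ cong₂ (λ a b → a + b + + ∣ e q ∣) (sym (sumℤ-pos k (λ j → ∣ e (vtx j) ∣))) (∣e∣≡e p) ⟩
    sumℤ k (λ j → + ∣ e (vtx j) ∣) + e p + + ∣ e q ∣
                                           ≡⟨ cong₂ (λ a b → a + e p + b) (sumℤ-cong k (∣e∣≡e ∘ vtx)) (∣e∣≡e q) ⟩
    sumℤ k (e ∘ vtx) + e p + e q           ≡⟨ deg-split k e ⟨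
    deg e                                  ≡⟨ deg-∼ {d} {e} d∼e ⟨
    deg d                                  ∎)
    where
    open ℤP.≤-Reasoning
    Σe = sumℕ k (λ j → ∣ e (vtx j) ∣)
    ∣e∣≡e : ∀ u → + ∣ e u ∣ ≡ e u
    ∣e∣≡e u = ℤP.0≤i⇒+∣i∣≡i (e≥0 u)

  quotientSum : Divisor N → ℕ → ℤ
  quotientSum d i = sumℤ k (λ j → shifted d i j /ℕ N)

  residue≡shifted-quotient : ∀ d i j → + residue d i j ≡ shifted d i j - shifted d i j /ℕ N * + N
  residue≡shifted-quotient d i j = trans (cancel (+ residue d i j) (shifted d i j /ℕ N * + N))
    (cong (_- shifted d i j /ℕ N * + N) (sym (ℤD.a≡a%ℕn+[a/ℕn]*n (shifted d i j) N)))
    where cancel : ∀ r m → r ≡ r + m - m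
          cancel = ℤSolver.solve-∀

  residueSum-decomposition : ∀ d i → + residueSum d i ≡ sumℤ k (shifted d i) - quotientSum d i * + N
  residueSum-decomposition d i = begin
    + residueSum d i                                                        ≡⟨ sumℤ-pos k (residue d i) ⟨
    sumℤ k (λ j → + residue d i j)                                          ≡⟨ sumℤ-cong k (residue≡shifted-quotient d i) ⟩
    sumℤ k (λ j → shifted d i j + - (shifted d i j /ℕ N * + N))             ≡⟨ sumℤ-distrib-+ k (shifted d i) _ ⟩
    sumℤ k (shifted d i) + sumℤ k (λ j → - (shifted d i j /ℕ N * + N))      ≡⟨ cong (λ x → sumℤ k (shifted d i) + x) (sumℤ-distrib-neg k _) ⟩
    sumℤ k (shifted d i) - sumℤ k (λ j → shifted d i j /ℕ N * + N)          ≡⟨ cong (λ x → sumℤ k (shifted d i) - x) (sumℤ-*ʳ k _ (+ N)) ⟩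
    sumℤ k (shifted d i) - quotientSum d i * + N                            ∎
    where open ≡-Reasoning

  sumℤ-shifted : ∀ d i → sumℤ k (shifted d i) ≡ sumℤ k (d ∘ vtx) + + k * (+ i - d p)
  sumℤ-shifted d i = begin
    sumℤ k (shifted d i)                             ≡⟨ sumℤ-cong k (λ j → ℤP.+-assoc (d (vtx j)) (- d p) (+ i)) ⟩
    sumℤ k (λ j → d (vtx j) + (- d p + + i))          ≡⟨ sumℤ-distrib-+ k (d ∘ vtx) _ ⟩
    sumℤ k (d ∘ vtx) + sumℤ k (λ _ → - d p + + i)     ≡⟨ cong (λ x → sumℤ k (d ∘ vtx) + x) (sumℤ-const k _) ⟩
    sumℤ k (d ∘ vtx) + + k * (- d p + + i)            ≡⟨ cong (λ x → sumℤ k (d ∘ vtx) + + k * x) (ℤP.+-comm (- d p) (+ i)) ⟩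
    sumℤ k (d ∘ vtx) + + k * (+ i - d p)             ∎
    where open ≡-Reasoning

  -- The witness puts the residues on v₁,…,vₙ₋₂, i chips on vₙ₋₁ and the rest of the degree on vₙ.
  Admissible⇒effective : ∀ d i → Admissible d i → ∃ λ e → Nonneg e × d ∼⟨ K N ⟩ e
  Admissible⇒effective d i good = e , e≥0 , y , laplacian-K-image (suc k) (λ u → d u - e u) y c d-e≡c+Ny deg[d-e]≡0
    where
    c = d p - + i
    quotient : Fin k → ℤ
    quotient j = shifted d i j /ℕ N
    e : Divisor N
    e = glue k (+_ ∘ residue d i) (+ i) (deg d - + i - + residueSum d i)
    y : Divisor N
    y = glue k quotient (+ 0) (- c - quotientSum d i)

    e≥0 : Nonneg e
    e≥0 u with vertex-cases k u
    ... | inj₁ (j , refl)  = subst (+ 0 ℤ.≤_) (sym (glue-vtx k _ _ _ j)) (ℤ.+≤+ z≤n)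
    ... | inj₂ (inj₁ refl) = subst (+ 0 ℤ.≤_) (sym (glue-vₙ₋₁ k (+_ ∘ residue d i) _ _)) (ℤ.+≤+ z≤n)
    ... | inj₂ (inj₂ refl) = subst (+ 0 ℤ.≤_) (sym (glue-vₙ k (+_ ∘ residue d i) _ _)) (ℤP.i≤j⇒0≤j-i good)

    deg-e : deg e ≡ deg d
    deg-e = begin
      deg e                                                   ≡⟨ deg-split k e ⟩
      sumℤ k (e ∘ vtx) + e p + e q
          ≡⟨ cong₂ (λ a b → a + b + e q) (trans (sumℤ-cong k (glue-vtx k _ _ _)) (sumℤ-pos k (residue d i))) (glue-vₙ₋₁ k (+_ ∘ residue d i) _ _) ⟩
      + residueSum d i + + i + e q                            ≡⟨ cong (λ x → + residueSum d i + + i + x) (glue-vₙ k (+_ ∘ residue d i) _ _) ⟩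
      + residueSum d i + + i + (deg d - + i - + residueSum d i) ≡⟨ cancel (+ residueSum d i) (+ i) (deg d) ⟩
      deg d                                                   ∎
      where open ≡-Reasoning
            cancel : ∀ s i D → s + i + (D - i - s) ≡ D
            cancel = ℤSolver.solve-∀

    deg[d-e]≡0 : sumℤ N (λ u → d u - e u) ≡ + 0
    deg[d-e]≡0 = trans (sumℤ-distrib-+ N d (-_ ∘ e))
                   (trans (cong (λ x → deg d + x) (trans (sumℤ-distrib-neg N e) (cong -_ deg-e))) (ℤP.+-inverseʳ (deg d)))

    d-e≡c+Ny : ∀ u → d u - e u ≡ c + y u * + N
    d-e≡c+Ny u with vertex-cases k u
    ... | inj₁ (j , refl) = begin
      d (vtx j) - e (vtx j)             ≡⟨ cong (λ x → d (vtx j) - x) (glue-vtx k _ _ _ j) ⟩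
      d (vtx j) - + residue d i j       ≡⟨ cong (λ x → d (vtx j) - x) (residue≡shifted-quotient d i j) ⟩
      d (vtx j) - (shifted d i j - quotient j * + N) ≡⟨ regroup (d (vtx j)) (d p) (+ i) (quotient j) (+ N) ⟩
      c + quotient j * + N                     ≡⟨ cong (λ x → c + x * + N) (glue-vtx k quotient _ _ j) ⟨
      c + y (vtx j) * + N               ∎
      where open ≡-Reasoning
            regroup : ∀ a b i q n → a - (a - b + i - q * n) ≡ b - i + q * n
            regroup = ℤSolver.solve-∀
    ... | inj₂ (inj₁ refl) = begin
      d p - e p                         ≡⟨ cong (λ x → d p - x) (glue-vₙ₋₁ k (+_ ∘ residue d i) _ _) ⟩
      c                                 ≡⟨ ℤP.+-identityʳ c ⟨
      c + + 0                           ≡⟨ cong (λ x → c + x * + N) (glue-vₙ₋₁ k quotient _ _) ⟨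
      c + y p * + N                     ∎
      where open ≡-Reasoning
    ... | inj₂ (inj₂ refl) = begin
      d q - e q                         ≡⟨ cong (λ x → d q - x) (glue-vₙ k (+_ ∘ residue d i) _ _) ⟩
      d q - (deg d - + i - + residueSum d i)
          ≡⟨ cong₂ (λ D S → d q - (D - + i - S)) (deg-split k d) (trans (residueSum-decomposition d i) (cong (_- quotientSum d i * + N) (sumℤ-shifted d i))) ⟩
      d q - (sumℤ k (d ∘ vtx) + d p + d q - + i - (sumℤ k (d ∘ vtx) + + k * (+ i - d p) - quotientSum d i * + N))
          ≡⟨ regroup (sumℤ k (d ∘ vtx)) (d p) (d q) (+ i) (+ k) (quotientSum d i) ⟩
      c + (- c - quotientSum d i) * + N ≡⟨ cong (λ x → c + x * + N) (glue-vₙ k quotient _ _) ⟨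
      c + y q * + N                     ∎
      where open ≡-Reasoning
            regroup : ∀ Σd P Qd I K QS → Qd - (Σd + P + Qd - I - (Σd + K * (I - P) - QS * (+ 1 + (+ 1 + K)))) ≡ (P - I) + (- (P - I) - QS) * (+ 1 + (+ 1 + K))
            regroup = ℤSolver.solve-∀

  ρ≡0⇒InN : ∀ d → ρ d ≡ 0 → InN (K N) d
  ρ≡0⇒InN d ρd≡0 (e , e≥0 , d∼e) = ℕP.<-irrefl (sym ρd≡0) (subst (1 ℕ.≤_) (sym (ρ≡count d M ∣deg∣<M))
    (count-pos (Admissible? d) M ∣ e p ∣ good (Admissible⇒<bound d M ∣deg∣<M _ good)))
    where
    M = suc ∣ deg d ∣
    ∣deg∣<M = ℕP.n<1+n ∣ deg d ∣
    good = Nonneg⇒Admissible {d} {e} e≥0 d∼e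

  InN⇒ρ≡0 : ∀ d → InN (K N) d → ρ d ≡ 0
  InN⇒ρ≡0 d d∈𝒩 with ρ d in ρd≡
  ... | zero  = refl
  ... | suc _ with count-witness (Admissible? d) M (subst (1 ℕ.≤_) (ρ≡count d M (ℕP.n<1+n _)) (subst (1 ℕ.≤_) (sym ρd≡) (s≤s z≤n)))
    where M = suc ∣ deg d ∣
  ...   | i , good = ⊥-elim (d∈𝒩 (Admissible⇒effective d i good))

  module _ {d d' : Divisor N} where

    residue-decrement-vₙ : Decrement d q d' → ∀ i j → residue d' i j ≡ residue d i j
    residue-decrement-vₙ (_ , agree) i j =
      cong₂ (λ a b → (a - b + + i) %ℕ N) (agree (vtx j) (vtx≢vₙ j)) (agree p (vₙ₋₁≢vₙ k))

    residue-decrement-vₙ₋₁ : Decrement d p d' → ∀ i j → residue d' i j ≡ residue d (suc i) j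
    residue-decrement-vₙ₋₁ (d'p≡dp-1 , agree) i j = cong (_%ℕ N) (begin
      d' (vtx j) - d' p + + i       ≡⟨ cong₂ (λ a b → a - b + + i) (agree (vtx j) (vtx≢vₙ₋₁ j)) d'p≡dp-1 ⟩
      d (vtx j) - (d p - + 1) + + i ≡⟨ regroup (d (vtx j)) (d p) (+ i) ⟩
      d (vtx j) - d p + (+ 1 + + i) ∎)
      where open ≡-Reasoning
            regroup : ∀ a b c → a - (b - + 1) + c ≡ a - b + (+ 1 + c)
            regroup = ℤSolver.solve-∀

    module _ {j₀ : Fin k} (d↘d' : Decrement d (vtx j₀) d') where

      residue-decrement-vtx-other : ∀ i j → j ≢ j₀ → residue d' i j ≡ residue d i j
      residue-decrement-vtx-other i j j≢j₀ =
        cong₂ (λ a b → (a - b + + i) %ℕ N) (proj₂ d↘d' (vtx j) (j≢j₀ ∘ vtx-injective)) (proj₂ d↘d' p (vtx≢vₙ₋₁ j₀ ∘ sym))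

      residue-decrement-vtx : ∀ i → residue d' i j₀ ≡ (shifted d i j₀ - + 1) %ℕ N
      residue-decrement-vtx i = cong (_%ℕ N) (begin
        d' (vtx j₀) - d' p + + i       ≡⟨ cong₂ (λ a b → a - b + + i) (proj₁ d↘d') (proj₂ d↘d' p (vtx≢vₙ₋₁ j₀ ∘ sym)) ⟩
        d (vtx j₀) - + 1 - d p + + i   ≡⟨ regroup (d (vtx j₀)) (d p) (+ i) ⟩
        d (vtx j₀) - d p + + i - + 1   ∎)
        where open ≡-Reasoning
              regroup : ∀ a b c → a - + 1 - b + c ≡ a - b + c - + 1
              regroup = ℤSolver.solve-∀

      residueSum-decrement-vtx : ∀ i → residueSum d' i ℕ.+ residue d i j₀ ≡ residueSum d i ℕ.+ residue d' i j₀
      residueSum-decrement-vtx i = sumℕ-exchange k (residue d' i) (residue d i) j₀ (residue-decrement-vtx-other i)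

      residue-decrement-vtx-≤ : ∀ i → residue d i j₀ ℕ.≤ suc (residue d' i j₀)
      residue-decrement-vtx-≤ i with residue d i j₀ in r≡
      ... | zero  = z≤n
      ... | suc r = s≤s (ℕP.≤-reflexive (sym (trans (residue-decrement-vtx i) (%ℕ-pred (suc k) (shifted d i j₀) r r≡))))

      residueSum-decrement-vtx-≤ : ∀ i → residueSum d i ℕ.≤ suc (residueSum d' i)
      residueSum-decrement-vtx-≤ i = ℕP.+-cancelʳ-≤ (residue d' i j₀) _ _ (begin
        residueSum d i ℕ.+ residue d' i j₀         ≡⟨ residueSum-decrement-vtx i ⟨
        residueSum d' i ℕ.+ residue d i j₀         ≤⟨ ℕP.+-monoʳ-≤ (residueSum d' i) (residue-decrement-vtx-≤ i) ⟩
        residueSum d' i ℕ.+ suc (residue d' i j₀)  ≡⟨ ℕP.+-suc _ _ ⟩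
        suc (residueSum d' i) ℕ.+ residue d' i j₀  ∎)
        where open ℕP.≤-Reasoning

  private
    +suc≡++1 : ∀ a → + suc a ≡ + a + + 1
    +suc≡++1 a = trans (cong +_ (ℕP.+-comm 1 a)) (ℤP.pos-+ a 1)

  module _ {d d' : Divisor N} {v} (d↘d' : Decrement d v d') where

    Admissible-decrement⇒ : ∀ i → Admissible d' i → + suc (residueSum d' i ℕ.+ i) ℤ.≤ deg d
    Admissible-decrement⇒ i good = subst (ℤ._≤ deg d) (sym (+suc≡++1 a))
      (i≤j-k⇒i+k≤j (+ a) (deg d) (+ 1) (subst (+ a ℤ.≤_) (deg-decrement d↘d') (Admissible⇒≤deg d' i good)))
      where a = residueSum d' i ℕ.+ i

    Admissible-decrement⇐ : ∀ i → + suc (residueSum d' i ℕ.+ i) ℤ.≤ deg d → Admissible d' i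
    Admissible-decrement⇐ i ≤deg = ≤deg⇒Admissible d' i (subst (+ a ℤ.≤_) (sym (deg-decrement d↘d'))
      (i+k≤j⇒i≤j-k (+ a) (deg d) (+ 1) (subst (ℤ._≤ deg d) (+suc≡++1 a) ≤deg)))
      where a = residueSum d' i ℕ.+ i

    Admissible-decrement-⊆ : ∀ i → residueSum d i ℕ.≤ suc (residueSum d' i) → Admissible d' i → Admissible d i
    Admissible-decrement-⊆ i S≤1+S' good = ≤deg⇒Admissible d i
      (ℤP.≤-trans (ℤ.+≤+ (ℕP.+-monoˡ-≤ i S≤1+S')) (Admissible-decrement⇒ i good))

  module _ {d d' : Divisor N} (d↘d' : Decrement d p d') where

    private
      deg-i≡ : ∀ i → deg d' - + i ≡ deg d - + suc i
      deg-i≡ i = trans (cong (_- + i) (deg-decrement d↘d')) (trans (regroup (deg d) (+ i)) (cong (λ x → deg d - x) (sym (+suc≡++1 i))))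
        where regroup : ∀ D i → D - + 1 - i ≡ D - (i + + 1)
              regroup = ℤSolver.solve-∀
      S≡ : ∀ i → residueSum d' i ≡ residueSum d (suc i)
      S≡ i = sumℕ-cong k (residue-decrement-vₙ₋₁ d↘d' i)

    Admissible-decrement-vₙ₋₁⇒ : ∀ i → Admissible d' i → Admissible d (suc i)
    Admissible-decrement-vₙ₋₁⇒ i = subst₂ (λ a b → + a ℤ.≤ b) (S≡ i) (deg-i≡ i)

    Admissible-decrement-vₙ₋₁⇐ : ∀ i → Admissible d (suc i) → Admissible d' i
    Admissible-decrement-vₙ₋₁⇐ i = subst₂ (λ a b → + a ℤ.≤ b) (sym (S≡ i)) (sym (deg-i≡ i))

  decrement-cases : ∀ {d d' v} → Decrement d v d' →
                    (∃ λ j₀ → Decrement d (vtx j₀) d') ⊎ Decrement d p d' ⊎ Decrement d q d'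
  decrement-cases {v = v} d↘d' with vertex-cases k v
  ... | inj₁ (j₀ , refl) = inj₁ (j₀ , d↘d')
  ... | inj₂ (inj₁ refl) = inj₂ (inj₁ d↘d')
  ... | inj₂ (inj₂ refl) = inj₂ (inj₂ d↘d')

  countBound : Divisor N → ℕ
  countBound d = suc (suc ∣ deg d ∣)

  ∣deg∣<countBound : ∀ d → ∣ deg d ∣ ℕ.< countBound d
  ∣deg∣<countBound d = ℕP.m<n⇒m<1+n (ℕP.n<1+n ∣ deg d ∣)

  ∣deg∣<countBound-decrement : ∀ {d d' v} → Decrement d v d' → ∣ deg d' ∣ ℕ.< countBound d
  ∣deg∣<countBound-decrement {d} d↘d' = subst (λ x → ∣ x ∣ ℕ.< countBound d) (sym (deg-decrement d↘d'))
    (s≤s (ℕP.≤-trans (ℤP.∣i+j∣≤∣i∣+∣j∣ (deg d) (- + 1)) (ℕP.≤-reflexive (ℕP.+-comm ∣ deg d ∣ 1))))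

  Lost : Divisor N → Divisor N → ℕ → Set
  Lost d d' i = Admissible d i × ¬ Admissible d' i

  module _ {d d' : Divisor N} {v} (d↘d' : Decrement d v d') where

    private
      M = countBound d
      ρd≡ = ρ≡count d M (∣deg∣<countBound d)
      ρd'≡ = ρ≡count d' M (∣deg∣<countBound-decrement d↘d')

    ρ-decrement-mono : (∀ i → Admissible d' i → Admissible d i) → ρ d' ℕ.≤ ρ d
    ρ-decrement-mono Adm'⊆Adm = subst₂ ℕ._≤_ (sym ρd'≡) (sym ρd≡) (count-mono (Admissible? d') (Admissible? d) M Adm'⊆Adm)

    ρ-decrement-strict : ∀ m → (∀ i → Admissible d' i → Admissible d i) → Admissible d m → ¬ Admissible d' m → ρ d' ℕ.< ρ d
    ρ-decrement-strict m Adm'⊆Adm good ¬good' = subst₂ ℕ._<_ (sym ρd'≡) (sym ρd≡)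
      (count-strict (Admissible? d) (Admissible? d') M m Adm'⊆Adm good ¬good' (Admissible⇒<bound d M (∣deg∣<countBound d) m good))

    ρ-decrement-lose-one : (∀ i i' → Lost d d' i → Lost d d' i' → i ≡ i') → ρ d ℕ.≤ suc (ρ d')
    ρ-decrement-lose-one unique = begin
      ρ d                                         ≡⟨ ρd≡ ⟩
      count (Admissible? d) M                     ≤⟨ count-⊆-∪ (Admissible? d) (Admissible? d') Lost? M Adm⊆Adm'∪Lost ⟩
      count (Admissible? d') M ℕ.+ count Lost? M  ≤⟨ ℕP.+-monoʳ-≤ (count (Admissible? d') M) (count-at-most-one Lost? M unique) ⟩
      count (Admissible? d') M ℕ.+ 1              ≡⟨ ℕP.+-comm _ 1 ⟩
      suc (count (Admissible? d') M)              ≡⟨ cong suc ρd'≡ ⟨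
      suc (ρ d')                                  ∎
      where
      open ℕP.≤-Reasoning
      Lost? : ∀ i → Dec (Lost d d' i)
      Lost? i with Admissible? d i | Admissible? d' i
      ... | yes good | no ¬good' = yes (good , ¬good')
      ... | yes _    | yes good' = no (λ (_ , ¬good') → ¬good' good')
      ... | no ¬good | _         = no (λ (good , _) → ¬good good)
      Adm⊆Adm'∪Lost : ∀ i → Admissible d i → Admissible d' i ⊎ Lost d d' i
      Adm⊆Adm'∪Lost i good with Admissible? d' i
      ... | yes good' = inj₁ good'
      ... | no ¬good' = inj₂ (good , ¬good')

  residueSum-periodic : ∀ d i i' z → + i' ≡ + i + z * + N → residueSum d i' ≡ residueSum d i
  residueSum-periodic d i i' z i'≡i+zN = sumℕ-cong k λ j → trans
    (cong (_%ℕ N) (trans (cong (λ x → d (vtx j) - d p + x) i'≡i+zN) (sym (ℤP.+-assoc (d (vtx j) - d p) (+ i) (z * + N)))))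
    (%ℕ-+-multiple (suc k) (shifted d i j) z)

  InWindow : Divisor N → ℕ → Set
  InWindow d i = + (residueSum d i ℕ.+ i) ℤ.≤ deg d × deg d ℤ.< + (residueSum d i ℕ.+ i ℕ.+ N)

  InWindow-unique : ∀ d i i' → InWindow d i → InWindow d i' → (∃ λ z → + i' ≡ + i + z * + N) → i ≡ i'
  InWindow-unique d i i' win win' (z , i'≡i+zN) =
    close-congruent⇒≡ N i i' z (i'<i+N win win' S≡) (i'<i+N win' win (sym S≡)) i'≡i+zN
    where
    S≡ : residueSum d i' ≡ residueSum d i
    S≡ = residueSum-periodic d i i' z i'≡i+zN
    i'<i+N : ∀ {i i'} → InWindow d i → InWindow d i' → residueSum d i' ≡ residueSum d i → i' ℕ.< i ℕ.+ N
    i'<i+N {i} {i'} (_ , deg<) (≤deg , _) S'≡S = ℕP.+-cancelˡ-< (residueSum d i) i' (i ℕ.+ N)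
      (subst₂ ℕ._<_ (cong (ℕ._+ i') S'≡S) (ℕP.+-assoc (residueSum d i) i N) (ℤP.drop‿+<+ (ℤP.≤-<-trans ≤deg deg<)))

  tight⇒InWindow : ∀ d i → deg d ≡ + (residueSum d i ℕ.+ i) → InWindow d i
  tight⇒InWindow d i tight = ℤP.≤-reflexive (sym tight) , subst (ℤ._< + (residueSum d i ℕ.+ i ℕ.+ N)) (sym tight) (ℤ.+<+ (ℕP.m<m+n _ (s≤s z≤n)))

  zero-residues-congruent : ∀ d j i i' → residue d i j ≡ 0 → residue d i' j ≡ 0 → ∃ λ z → + i' ≡ + i + z * + N
  zero-residues-congruent d j i i' r≡0 r'≡0 = shifted d i' j /ℕ N - shifted d i j /ℕ N , (begin
    + i'                                              ≡⟨ regroup (d (vtx j) - d p) (+ i) (+ i') ⟩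
    + i + (shifted d i' j - shifted d i j)            ≡⟨ cong (λ x → + i + x) (cong₂ _-_ (decompose i' r'≡0) (decompose i r≡0)) ⟩
    + i + (+ 0 + quot' * + N - (+ 0 + quot * + N))          ≡⟨ cong (λ x → + i + x) (collect quot' quot (+ N)) ⟩
    + i + (quot' - quot) * + N                              ∎)
    where
    open ≡-Reasoning
    quot = shifted d i j /ℕ N
    quot' = shifted d i' j /ℕ N
    decompose : ∀ i → residue d i j ≡ 0 → shifted d i j ≡ + 0 + shifted d i j /ℕ N * + N
    decompose i r≡0 = trans (ℤD.a≡a%ℕn+[a/ℕn]*n (shifted d i j) N) (cong (λ r → + r + shifted d i j /ℕ N * + N) r≡0)
    regroup : ∀ a c c' → c' ≡ c + ((a + c') - (a + c))
    regroup = ℤSolver.solve-∀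
    collect : ∀ x y n → (+ 0 + x * n) - (+ 0 + y * n) ≡ (x - y) * n
    collect = ℤSolver.solve-∀

  tight-indices-congruent : ∀ d i i' → deg d ≡ + (residueSum d i ℕ.+ i) → deg d ≡ + (residueSum d i' ℕ.+ i') →
                            ∃ λ z → + i' ≡ + i + z * + N
  tight-indices-congruent d i i' tight tight' = + i' - + i - quotientSum d i' + quotientSum d i , (begin
    + i'                                                  ≡⟨ ℤP.+-identityʳ (+ i') ⟨
    + i' + + 0                                            ≡⟨ cong (λ x → + i' + x) (ℤP.+-inverseʳ (E i)) ⟨
    + i' + (E i - E i)                                    ≡⟨ cong (λ x → + i' + (x - E i)) E≡ ⟩
    + i' + (E i' - E i)                                   ≡⟨ regroup (sumℤ k (d ∘ vtx)) (d p) (+ k) (+ i) (+ i') (quotientSum d i) (quotientSum d i') ⟨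
    + i + (+ i' - + i - quotientSum d i' + quotientSum d i) * + N ∎)
    where
    open ≡-Reasoning
    E : ℕ → ℤ
    E i = sumℤ k (d ∘ vtx) + + k * (+ i - d p) - quotientSum d i * + N + + i
    E-deg : ∀ i → deg d ≡ + (residueSum d i ℕ.+ i) → deg d ≡ E i
    E-deg i tight = trans tight (trans (ℤP.pos-+ (residueSum d i) i)
      (cong (_+ + i) (trans (residueSum-decomposition d i) (cong (_- quotientSum d i * + N) (sumℤ-shifted d i)))))
    E≡ : E i ≡ E i'
    E≡ = trans (sym (E-deg i tight)) (E-deg i' tight')
    regroup : ∀ A P K i i' Q Q' → i + (i' - i - Q' + Q) * (+ 1 + (+ 1 + K))
              ≡ i' + ((A + K * (i' - P) - Q' * (+ 1 + (+ 1 + K)) + i') - (A + K * (i - P) - Q * (+ 1 + (+ 1 + K)) + i))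
    regroup = ℤSolver.solve-∀

  Lost-vₙ⇒tight : ∀ {d d'} → Decrement d q d' → ∀ i → Lost d d' i → deg d ≡ + (residueSum d i ℕ.+ i)
  Lost-vₙ⇒tight {d} {d'} d↘d' i (good , ¬good') = ℤP.≤-antisym
    (ℤP.i<j⇒i≤pred[j] (ℤP.≰⇒> λ ≤deg → ¬good' (Admissible-decrement⇐ d↘d' i (subst (λ s → + suc (s ℕ.+ i) ℤ.≤ deg d) (sym S≡) ≤deg))))
    (Admissible⇒≤deg d i good)
    where S≡ = sumℕ-cong k (residue-decrement-vₙ d↘d' i)

  module _ {d d' : Divisor N} {j₀ : Fin k} (d↘d' : Decrement d (vtx j₀) d') where

    residueSum-decrement-vtx-suc : ∀ i r → residue d i j₀ ≡ suc r → residueSum d i ≡ suc (residueSum d' i)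
    residueSum-decrement-vtx-suc i r r≡ = ℕP.+-cancelʳ-≡ r _ _ (sym (begin
      suc (residueSum d' i) ℕ.+ r        ≡⟨ ℕP.+-suc _ r ⟨
      residueSum d' i ℕ.+ suc r          ≡⟨ cong (residueSum d' i ℕ.+_) r≡ ⟨
      residueSum d' i ℕ.+ residue d i j₀ ≡⟨ residueSum-decrement-vtx d↘d' i ⟩
      residueSum d i ℕ.+ residue d' i j₀ ≡⟨ cong (residueSum d i ℕ.+_) r'≡r ⟩
      residueSum d i ℕ.+ r               ∎))
      where open ≡-Reasoning
            r'≡r = trans (residue-decrement-vtx d↘d' i) (%ℕ-pred (suc k) (shifted d i j₀) r r≡)

    residueSum-decrement-vtx-zero : ∀ i → residue d i j₀ ≡ 0 → residueSum d' i ≡ residueSum d i ℕ.+ suc k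
    residueSum-decrement-vtx-zero i r≡0 = begin
      residueSum d' i                    ≡⟨ ℕP.+-identityʳ _ ⟨
      residueSum d' i ℕ.+ 0              ≡⟨ cong (residueSum d' i ℕ.+_) r≡0 ⟨
      residueSum d' i ℕ.+ residue d i j₀ ≡⟨ residueSum-decrement-vtx d↘d' i ⟩
      residueSum d i ℕ.+ residue d' i j₀ ≡⟨ cong (residueSum d i ℕ.+_) r'≡top ⟩
      residueSum d i ℕ.+ suc k           ∎
      where open ≡-Reasoning
            r'≡top = trans (residue-decrement-vtx d↘d' i) (%ℕ-pred-wrap (suc k) (shifted d i j₀) r≡0)

    Admissible-decrement-vtx-zero⇔ : ∀ i → residue d i j₀ ≡ 0 →
                               (Admissible d' i → + (residueSum d i ℕ.+ i ℕ.+ N) ℤ.≤ deg d) × (+ (residueSum d i ℕ.+ i ℕ.+ N) ℤ.≤ deg d → Admissible d' i)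
    Admissible-decrement-vtx-zero⇔ i r≡0 = subst (ℤ._≤ deg d) (cong +_ S'+i≡) ∘ Admissible-decrement⇒ d↘d' i
                                  , Admissible-decrement⇐ d↘d' i ∘ subst (ℤ._≤ deg d) (cong +_ (sym S'+i≡))
      where
      S'+i≡ : suc (residueSum d' i ℕ.+ i) ≡ residueSum d i ℕ.+ i ℕ.+ N
      S'+i≡ = trans (cong (λ s → suc (s ℕ.+ i)) (residueSum-decrement-vtx-zero i r≡0)) (shuffle (residueSum d i) i k)
        where shuffle : ∀ s i k → suc (s ℕ.+ suc k ℕ.+ i) ≡ s ℕ.+ i ℕ.+ suc (suc k)
              shuffle = ℕSolver.solve-∀

    Lost-vtx⇒ : ∀ i → Lost d d' i → residue d i j₀ ≡ 0 × InWindow d i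
    Lost-vtx⇒ i (good , ¬good') with residue d i j₀ in r≡
    ... | suc r = ⊥-elim (¬good' (Admissible-decrement⇐ d↘d' i
                    (ℤP.≤-trans (ℤ.+≤+ (ℕP.≤-reflexive (cong (ℕ._+ i) (sym (residueSum-decrement-vtx-suc i r r≡))))) (Admissible⇒≤deg d i good))))
    ... | zero  = refl , Admissible⇒≤deg d i good , ℤP.≰⇒> (¬good' ∘ proj₂ (Admissible-decrement-vtx-zero⇔ i r≡))

  ρ-decrement-≤ : ∀ {d d' v} → Decrement d v d' → ρ d' ℕ.≤ ρ d
  ρ-decrement-≤ {d} {d'} d↘d' with decrement-cases d↘d'
  ... | inj₁ (j₀ , d↘d'at) = ρ-decrement-mono d↘d' λ i → Admissible-decrement-⊆ d↘d' i (residueSum-decrement-vtx-≤ d↘d'at i)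
  ... | inj₂ (inj₂ d↘d'at) = ρ-decrement-mono d↘d' λ i →
          Admissible-decrement-⊆ d↘d' i (ℕP.≤-trans (ℕP.≤-reflexive (sumℕ-cong k (sym ∘ residue-decrement-vₙ d↘d'at i))) (ℕP.n≤1+n _))
  ... | inj₂ (inj₁ d↘d'at) = begin
    ρ d'                           ≡⟨ ρ≡count d' M (∣deg∣<countBound-decrement d↘d') ⟩
    count (Admissible? d') M
        ≡⟨ count-cong (Admissible? d') (Admissible? d ∘ suc) M (Admissible-decrement-vₙ₋₁⇒ d↘d'at) (Admissible-decrement-vₙ₋₁⇐ d↘d'at) ⟩
    count (Admissible? d ∘ suc) M        ≤⟨ count-suc-≥ (Admissible? d) M ⟩
    count (Admissible? d) (suc M)        ≡⟨ ρ≡count d (suc M) (ℕP.m<n⇒m<1+n (∣deg∣<countBound d)) ⟨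
    ρ d                            ∎
    where open ℕP.≤-Reasoning
          M = countBound d

  ρ-≤-decrement : ∀ {d d' v} → Decrement d v d' → ρ d ℕ.≤ suc (ρ d')
  ρ-≤-decrement {d} {d'} d↘d' with decrement-cases d↘d'
  ... | inj₁ (j₀ , d↘d'at) = ρ-decrement-lose-one d↘d' λ i i' lost lost' →
          let (r≡0 , win) = Lost-vtx⇒ d↘d'at i lost; (r'≡0 , win') = Lost-vtx⇒ d↘d'at i' lost'
          in InWindow-unique d i i' win win' (zero-residues-congruent d j₀ i i' r≡0 r'≡0)
  ... | inj₂ (inj₂ d↘d'at) = ρ-decrement-lose-one d↘d' λ i i' lost lost' →
          let tight = Lost-vₙ⇒tight d↘d'at i lost; tight' = Lost-vₙ⇒tight d↘d'at i' lost'
          in InWindow-unique d i i' (tight⇒InWindow d i tight) (tight⇒InWindow d i' tight') (tight-indices-congruent d i i' tight tight')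
  ... | inj₂ (inj₁ d↘d'at) = begin
    ρ d                            ≡⟨ ρ≡count d (suc M) (ℕP.m<n⇒m<1+n (∣deg∣<countBound d)) ⟩
    count (Admissible? d) (suc M)        ≤⟨ count-suc-≤ (Admissible? d) M ⟩
    suc (count (Admissible? d ∘ suc) M)
        ≡⟨ cong suc (count-cong (Admissible? d ∘ suc) (Admissible? d') M (Admissible-decrement-vₙ₋₁⇐ d↘d'at) (Admissible-decrement-vₙ₋₁⇒ d↘d'at)) ⟩
    suc (count (Admissible? d') M)       ≡⟨ cong suc (ρ≡count d' M (∣deg∣<countBound-decrement d↘d')) ⟨
    suc (ρ d')                     ∎
    where open ℕP.≤-Reasoning
          M = countBound d

  shifted-suc : ∀ d m j → shifted d (suc m) j ≡ shifted d m j + + 1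
  shifted-suc d m j = trans (cong (λ t → d (vtx j) - d p + t) (ℤP.pos-+ 1 m)) (regroup (d (vtx j) - d p) (+ m))
    where regroup : ∀ a b → a + (+ 1 + b) ≡ a + b + + 1
          regroup = ℤSolver.solve-∀

  shifted-+ : ∀ d m t j → shifted d (m ℕ.+ t) j ≡ shifted d m j + + t
  shifted-+ d m t j = trans (cong (λ x → d (vtx j) - d p + x) (ℤP.pos-+ m t)) (sym (ℤP.+-assoc (d (vtx j) - d p) (+ m) (+ t)))

  residue-suc : ∀ d m j → residue d m j ≢ suc k → residue d (suc m) j ≡ suc (residue d m j)
  residue-suc d m j r≢top = trans (cong (_%ℕ N) (shifted-suc d m j))
    (%ℕ-suc (suc k) (shifted d m j) _ refl (s≤s (ℕP.≤∧≢⇒< (ℕP.≤-pred (ℤD.n%ℕd<d (shifted d m j) N)) r≢top)))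

  residue-suc-wrap : ∀ d m j → residue d m j ≡ suc k → residue d (suc m) j ≡ 0
  residue-suc-wrap d m j r≡top = trans (cong (_%ℕ N) (shifted-suc d m j)) (%ℕ-suc-wrap (suc k) (shifted d m j) r≡top)

  Admissible-suc-if-wrap : ∀ d m j₀ → Admissible d m → residue d m j₀ ≡ suc k → Admissible d (suc m)
  Admissible-suc-if-wrap d m j₀ good r≡top = ≤deg⇒Admissible d (suc m) (ℤP.≤-trans (ℤ.+≤+ S'+1+m≤S+m) (Admissible⇒≤deg d m good))
    where
    S = residueSum d m
    S' = residueSum d (suc m)
    residue-suc-≤ : ∀ j → residue d (suc m) j ℕ.≤ suc (residue d m j)
    residue-suc-≤ j with residue d m j ℕ.≟ suc k
    ... | yes r≡top = ℕP.≤-trans (ℕP.≤-reflexive (residue-suc-wrap d m j r≡top)) z≤n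
    ... | no  r≢top = ℕP.≤-reflexive (residue-suc d m j r≢top)
    S'+N≤S+k : S' ℕ.+ N ℕ.≤ S ℕ.+ k
    S'+N≤S+k = subst (S' ℕ.+ N ℕ.≤_) (sumℕ-suc k (residue d m))
      (sumℕ-mono-≤-at k j₀ N residue-suc-≤ (ℕP.≤-reflexive (trans (cong (ℕ._+ N) (residue-suc-wrap d m j₀ r≡top)) (cong suc (sym r≡top)))))
    S'+1+m≤S+m : S' ℕ.+ suc m ℕ.≤ S ℕ.+ m
    S'+1+m≤S+m = ℕP.+-cancelʳ-≤ (suc k) _ _ (begin
      S' ℕ.+ suc m ℕ.+ suc k     ≡⟨ shuffle S' m k ⟩
      S' ℕ.+ N ℕ.+ m             ≤⟨ ℕP.+-monoˡ-≤ m S'+N≤S+k ⟩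
      S ℕ.+ k ℕ.+ m              ≤⟨ ℕP.≤-reflexive (swap S k m) ⟩
      S ℕ.+ m ℕ.+ k              ≤⟨ ℕP.+-monoʳ-≤ (S ℕ.+ m) (ℕP.n≤1+n k) ⟩
      S ℕ.+ m ℕ.+ suc k          ∎)
      where open ℕP.≤-Reasoning
            shuffle : ∀ a b c → a ℕ.+ suc b ℕ.+ suc c ≡ a ℕ.+ suc (suc c) ℕ.+ b
            shuffle = ℕSolver.solve-∀
            swap : ∀ a b c → a ℕ.+ b ℕ.+ c ≡ a ℕ.+ c ℕ.+ b
            swap = ℕSolver.solve-∀

  Admissible-suc-if-room : ∀ d m → (∀ j → residue d m j ≢ suc k) → + (residueSum d m ℕ.+ m ℕ.+ suc k) ℤ.≤ deg d → Admissible d (suc m)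
  Admissible-suc-if-room d m no-wrap room = ≤deg⇒Admissible d (suc m) (subst (λ x → + x ℤ.≤ deg d) (sym S'+1+m≡) room)
    where
    S'+1+m≡ : residueSum d (suc m) ℕ.+ suc m ≡ residueSum d m ℕ.+ m ℕ.+ suc k
    S'+1+m≡ = trans (cong (ℕ._+ suc m) (trans (sumℕ-cong k (λ j → residue-suc d m j (no-wrap j))) (sumℕ-suc k (residue d m))))
                    (shuffle (residueSum d m) m k)
      where shuffle : ∀ a b c → a ℕ.+ c ℕ.+ suc b ≡ a ℕ.+ b ℕ.+ suc c
            shuffle = ℕSolver.solve-∀

  -- Shifting by N − 1 lowers every nonzero residue by one.
  Admissible-+N-1-if-slack : ∀ d m → (∀ j → residue d m j ≢ 0) → Admissible d m → deg d ≢ + (residueSum d m ℕ.+ m) → Admissible d (m ℕ.+ suc k)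
  Admissible-+N-1-if-slack d m no-zero good not-tight =
    ≤deg⇒Admissible d _ (subst (λ x → + x ℤ.≤ deg d) (trans (cong (λ x → suc (x ℕ.+ m)) (sym S'+k≡S)) (shuffle S' m k)) S+m<deg)
    where
    S' = residueSum d (m ℕ.+ suc k)
    residue-pred : ∀ j → suc (residue d (m ℕ.+ suc k) j) ≡ residue d m j
    residue-pred j with residue d m j in r≡
    ... | zero  = ⊥-elim (no-zero j r≡)
    ... | suc r = cong suc (trans (cong (_%ℕ N) (shifted-+ d m (suc k) j)) (%ℕ-+-pred (suc k) (shifted d m j) r r≡))
    S'+k≡S : S' ℕ.+ k ≡ residueSum d m
    S'+k≡S = trans (sym (sumℕ-suc k (residue d (m ℕ.+ suc k)))) (sumℕ-cong k residue-pred)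
    S+m<deg : + suc (residueSum d m ℕ.+ m) ℤ.≤ deg d
    S+m<deg = ℤP.i<j⇒suc[i]≤j (ℤP.≤∧≢⇒< (Admissible⇒≤deg d m good) (not-tight ∘ sym))
    shuffle : ∀ a b c → suc (a ℕ.+ c ℕ.+ b) ≡ a ℕ.+ (b ℕ.+ suc c)
    shuffle = ℕSolver.solve-∀

  -- Removing a chip from vₙ, or from a vertex whose residue at the greatest admissible index m is 0,
  -- keeps every admissible index admissible and makes m inadmissible; the remaining cases contradict maximality of m.
  ρ-descent : ∀ d → 1 ℕ.≤ ρ d → ∃ λ v → ∃ λ d' → Decrement d v d' × ρ d' ℕ.< ρ d
  ρ-descent d ρ≥1 with greatest (Admissible? d) ∣ deg d ∣ (λ i → ℕP.≤-pred ∘ Admissible⇒<bound d _ ℕP.≤-refl i)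
                         (count-witness (Admissible? d) _ (subst (1 ℕ.≤_) (ρ≡count d _ ℕP.≤-refl) ρ≥1))
  ... | m , good , m-greatest with FP.any? (λ j → residue d m j ℕ.≟ suc k)
  ... | yes (j₀ , wrap) = ⊥-elim (ℕP.<-irrefl refl (m-greatest (suc m) (Admissible-suc-if-wrap d m j₀ good wrap)))
  ... | no no-wrap with + (residueSum d m ℕ.+ m ℕ.+ suc k) ℤ.≤? deg d
  ... | yes room = ⊥-elim (ℕP.<-irrefl refl (m-greatest (suc m) (Admissible-suc-if-room d m (λ j r≡top → no-wrap (j , r≡top)) room)))
  ... | no no-room with FP.any? (λ j → residue d m j ℕ.≟ 0)
  ... | yes (j₀ , r≡0) = vtx j₀ , d' , d↘d' ,
      ρ-decrement-strict d↘d' m (λ i → Admissible-decrement-⊆ d↘d' i (residueSum-decrement-vtx-≤ d↘d' i)) good ¬good'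
    where
    d' = updateAt d (vtx j₀) (_- + 1)
    d↘d' = decrementAt d (vtx j₀)
    ¬good' : ¬ Admissible d' m
    ¬good' good' = no-room (ℤP.≤-trans (ℤ.+≤+ (ℕP.+-monoʳ-≤ (residueSum d m ℕ.+ m) (ℕP.n≤1+n (suc k))))
                                       (proj₁ (Admissible-decrement-vtx-zero⇔ d↘d' m r≡0) good'))
  ... | no no-zero with deg d ℤ.≟ + (residueSum d m ℕ.+ m)
  ... | yes tight = vₙ k , d' , d↘d' ,
      ρ-decrement-strict d↘d' m (λ i → Admissible-decrement-⊆ d↘d' i (ℕP.≤-trans (ℕP.≤-reflexive (sym (S≡ i))) (ℕP.n≤1+n _))) good ¬good'
    where
    d' = updateAt d (vₙ k) (_- + 1)
    d↘d' = decrementAt d (vₙ k)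
    S≡ : ∀ i → residueSum d' i ≡ residueSum d i
    S≡ i = sumℕ-cong k (residue-decrement-vₙ d↘d' i)
    ¬good' : ¬ Admissible d' m
    ¬good' good' = ℕP.<-irrefl refl (ℤP.drop‿+≤+ (subst₂ (λ s D → + suc (s ℕ.+ m) ℤ.≤ D) (S≡ m) tight (Admissible-decrement⇒ d↘d' m good')))
  ... | no slack = ⊥-elim (ℕP.<-irrefl refl (ℕP.<-≤-trans (ℕP.m<m+n m (s≤s z≤n))
                     (m-greatest _ (Admissible-+N-1-if-slack d m (λ j r≡0 → no-zero (j , r≡0)) good slack))))

  ρ-adjacent : ∀ d d' → Adjacent d d' → ρ d' ℕ.≤ suc (ρ d)
  ρ-adjacent d d' (_ , inj₁ d↘d') = ℕP.m≤n⇒m≤1+n (ρ-decrement-≤ d↘d')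
  ρ-adjacent d d' (_ , inj₂ d'↘d) = ρ-≤-decrement d'↘d

  rankBN-K : ∀ d → RankBN (K N) d (-[1+ 0 ] + + ρ d)
  rankBN-K d = ρ d , ρ-is-dist₁ d , ℤP.+-comm -[1+ 0 ] (+ ρ d)
    where open DistanceByDescent (InN (K N)) ρ ρ-cong InN⇒ρ≡0 ρ≡0⇒InN ρ-adjacent ρ-descent

  ρ-normalised : ∀ d → d p ≡ + 0 → ρ d ≡ countLe (deg d) (λ i → + sumℕ k (λ j → (d (vtx j) + + i) %ℕ N)) (λ i → deg d - + i)
  ρ-normalised d dp≡0 = countLe-cong (deg d) (λ i → deg d - + i) λ i → cong +_ (sumℕ-cong k λ j →
    trans (cong (λ x → (d (vtx j) - x + + i) %ℕ N) dp≡0) (cong (λ x → (x + + i) %ℕ N) (ℤP.+-identityʳ (d (vtx j)))))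

corollary6p9 : (k : ℕ) →
    ((a : Divisor (suc (suc k))) → InA k a →
      RankBN (K (suc (suc k))) a
        (-[1+ 0 ] + + countLe (deg a)
           (λ i → + sumℕ k (λ j → (a (vtx j) + + i) %ℕ suc (suc k)))
           (λ i → deg a - + i)))
  × ((d : Divisor (suc (suc k))) →
      RankBN (K (suc (suc k))) d
        (-[1+ 0 ] + + countLe (deg d)
           (λ i → + sumℕ k (λ j → (d (vtx j) - d (vₙ₋₁ k) + + i) %ℕ suc (suc k)))
           (λ i → deg d - + i)))
corollary6p9 k = (λ a (_ , a[vₙ₋₁]≡0) → subst (λ r → RankBN (K N) a (-[1+ 0 ] + + r)) (ρ-normalised a a[vₙ₋₁]≡0) (rankBN-K a))
               , rankBN-K
  where open CompleteGraph k
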